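{- Fix $w\in W$ and let $P$ be an MV polytope. The following are equivalent: (i) $P \in \mathcal{P}_w$; (ii) there exists a reduced word $\underline{i}=(i_1,\dots,i_m)$ of $w_0$ with $(i_1,\dots,i_{\ell(w)})$ a reduced word of $w$ such that the Lusztig data $n^{\underline{i}}_\bullet(P)$ satisfy $n_k = 0$ for all $k > \ell(w)$; (iii) for every reduced word $\underline{i}$ of $w_0$ with $(i_1,\dots,i_{\ell(w)})$ a reduced word of $w$, the Lusztig data $n^{\underline{i}}_\bullet(P)$ satisfy $n_k = 0$ for all $k > \ell(w)$.
   Context: $G$ is a semisimple, simply connected complex algebraic group with Weyl group $W$ (simple reflections $s_i$, length $\ell$, longest element $w_0$, $m=\ell(w_0)$), simple coroots $\alpha_i^\vee$. An MV polytope (in the sense of Kamnitzer) has vertex data $(\mu_v)_{v\in W}$ in the coroot lattice, $P=\mathrm{conv}\{\mu_v\}$, with hyperplane data forming a BZ datum. $\mathcal{P}_w$ is the set of MV polytopes with $\mu_w=\mu_{w_0}$. For a reduced word $\underline{i}$ of $w_0$, $w_k=s_{i_1}\cdots s_{i_k}$, and the Lusztig data are the integers $n_k\ge 0$ with $\mu_{w_k}-\mu_{w_{k-1}}=n_k\, w_{k-1}\alpha_{i_k}^\vee$. -}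

module Defs where

open import Data.Nat using (ℕ; zero; suc) renaming (_≤_ to _≤ℕ_; _<_ to _<ℕ_)
open import Data.Integer using (ℤ; +_; -[1+_]; 0ℤ; _+_; _-_; _*_; _⊓_; _≤_; _<_)
open import Data.Fin using (Fin; zero; suc; _≟_)
open import Data.List using (List; []; _∷_; _++_; [_]; length; map; drop)
open import Data.List.Relation.Unary.All using (All)
open import Data.Product using (Σ; ∃; ∃-syntax; _×_; _,_)
open import Data.Unit using (⊤)
open import Data.Empty using (⊥)
open import Relation.Nullary using (¬_; does)
open import Relation.Binary.PropositionalEquality using (_≡_; _≢_)
open import Data.Bool using (if_then_else_)
open import Function using (_∘_)

sumFin : ∀ {r} → (Fin r → ℤ) → ℤ
sumFin {zero}  f = 0ℤ
sumFin {suc r} f = f zero + sumFin (f ∘ suc)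

-- Cartan matrix of finite type (= root datum of a semisimple simply
-- connected complex group G).  Convention: a i j = ⟨α_i^∨ , α_j⟩.

record CartanMatrix (r : ℕ) : Set where
  field
    a          : Fin r → Fin r → ℤ
    a-diag     : ∀ i → a i i ≡ + 2
    a-offdiag  : ∀ i j → i ≢ j → a i j ≤ 0ℤ
    a-zero     : ∀ i j → a i j ≡ 0ℤ → a j i ≡ 0ℤ
    -- symmetrizable with positive definite symmetrization (finite type)
    d          : Fin r → ℕ
    d-pos      : ∀ i → 0 <ℕ d i
    d-sym      : ∀ i j → + d i * a i j ≡ + d j * a j i
    posdef     : ∀ (x : Fin r → ℤ) → (∃[ i ] (x i ≢ 0ℤ)) →
                 0ℤ < sumFin (λ i → sumFin (λ j → x i * (+ d i * a i j) * x j))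

-- Coroot lattice (coordinates w.r.t. the simple coroots α_i^∨),
-- Weyl group elements as words in the simple reflections.

Coroot : ℕ → Set
Coroot r = Fin r → ℤ

Word : ℕ → Set
Word r = List (Fin r)

_≐_ : ∀ {r} → Coroot r → Coroot r → Set
x ≐ y = ∀ k → x k ≡ y k

_⊕_ : ∀ {r} → Coroot r → Coroot r → Coroot r
(x ⊕ y) k = x k + y k

_⊙_ : ∀ {r} → ℕ → Coroot r → Coroot r
(n ⊙ x) k = + n * x k

simpleCoroot : ∀ {r} → Fin r → Coroot r
simpleCoroot i k = if does (k ≟ i) then + 1 else 0ℤ

module Weyl {r : ℕ} (C : CartanMatrix r) where
  open CartanMatrix C

  pairRoot : Coroot r → Fin r → ℤ
  pairRoot x i = sumFin (λ k → x k * a k i)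

  refl-s : Fin r → Coroot r → Coroot r
  refl-s i x k = if does (k ≟ i) then x k - pairRoot x i else x k

  act : Word r → Coroot r → Coroot r
  act []       x = x
  act (i ∷ is) x = refl-s i (act is x)

  -- equality in W (W acts faithfully on the coroot lattice)
  _≈W_ : Word r → Word r → Set
  u ≈W v = ∀ x → act u x ≐ act v x

  Reduced : Word r → Set
  Reduced u = ∀ v → u ≈W v → length u ≤ℕ length v

  IsReducedWordOf : Word r → Word r → Set
  IsReducedWordOf u w = Reduced u × u ≈W w

  IsLongestWord : Word r → Set
  IsLongestWord u = Reduced u × (∀ v → Reduced v → length v ≤ℕ length u)

  LusztigAlong : (Word r → Coroot r) → Word r → Word r → List ℕ → Set
  LusztigAlong μ base []       []       = ⊤
  LusztigAlong μ base []       (_ ∷ _)  = ⊥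
  LusztigAlong μ base (_ ∷ _)  []       = ⊥
  LusztigAlong μ base (i ∷ is) (n ∷ ns) =
    (μ (base ++ [ i ]) ≐ (μ base ⊕ (n ⊙ act base (simpleCoroot i)))) ×
    LusztigAlong μ (base ++ [ i ]) is ns

  LusztigDatum : (Word r → Coroot r) → Word r → List ℕ → Set
  LusztigDatum μ i n = LusztigAlong μ [] i n

-- Lusztig's rank 2 piecewise-linear transition maps (tropical, min-plus)

-- type A2 : word (i,j,i) ↦ (j,i,j)
RA2 : List ℤ → List ℤ
RA2 (x ∷ y ∷ z ∷ []) = let m = x ⊓ z in (y + z - m) ∷ m ∷ (x + y - m) ∷ []
RA2 _ = []

-- type B2 : word (i,j,i,j) ↦ (j,i,j,i), where a_{ij} = -2, a_{ji} = -1
RB2 : List ℤ → List ℤ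
RB2 (x ∷ y ∷ z ∷ t ∷ []) =
  let p₁ = ((x + y) ⊓ (x + t)) ⊓ (z + t)
      p₂ = ((+ 2 * x + y) ⊓ (+ 2 * x + t)) ⊓ (+ 2 * z + t)
  in (y + + 2 * z + t - p₂) ∷ (p₂ - p₁) ∷ (+ 2 * p₁ - p₂) ∷ (x + y + z - p₁) ∷ []
RB2 _ = []

-- type G2 : word (i,j,i,j,i,j) ↦ (j,i,j,i,j,i), where a_{ij} = -3,
-- a_{ji} = -1; obtained by folding D4 (nodes 0,1,2 outer, 3 central):
-- the letter i becomes the three outer nodes, j the central one, and the
-- type A2 moves / commutations below transform the D4 word
-- (0123)(0123)(0123) into (3012)(3012)(3012).

data Move : Set where
  swp : ℕ → Move
  brd : ℕ → Move

applyMove : Move → List ℤ → List ℤ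
applyMove (swp zero)    (x ∷ y ∷ l)     = y ∷ x ∷ l
applyMove (brd zero)    (x ∷ y ∷ z ∷ l) = RA2 (x ∷ y ∷ z ∷ []) ++ l
applyMove (swp (suc k)) (x ∷ l)         = x ∷ applyMove (swp k) l
applyMove (brd (suc k)) (x ∷ l)         = x ∷ applyMove (brd k) l
applyMove _             l               = l

applyMoves : List Move → List ℤ → List ℤ
applyMoves []       l = l
applyMoves (m ∷ ms) l = applyMoves ms (applyMove m l)

foldingMovesD4 : List Move
foldingMovesD4 =
  swp 4 ∷ swp 5 ∷ swp 4 ∷ brd 2 ∷ brd 6 ∷ brd 4 ∷ swp 3 ∷ swp 6 ∷ brd 1 ∷
  brd 3 ∷ swp 5 ∷ brd 7 ∷ brd 9 ∷ swp 8 ∷ brd 6 ∷ brd 4 ∷ swp 3 ∷ swp 2 ∷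
  swp 6 ∷ brd 0 ∷ brd 4 ∷ brd 2 ∷ swp 4 ∷ brd 8 ∷ swp 7 ∷ brd 5 ∷ brd 3 ∷
  swp 5 ∷ brd 7 ∷ swp 6 ∷ swp 5 ∷ []

unfoldG2 : List ℤ → List ℤ
unfoldG2 (x₁ ∷ x₂ ∷ x₃ ∷ x₄ ∷ x₅ ∷ x₆ ∷ []) =
  x₁ ∷ x₁ ∷ x₁ ∷ x₂ ∷ x₃ ∷ x₃ ∷ x₃ ∷ x₄ ∷ x₅ ∷ x₅ ∷ x₅ ∷ x₆ ∷ []
unfoldG2 _ = []

refoldG2 : List ℤ → List ℤ
refoldG2 (y₁ ∷ y₂ ∷ _ ∷ _ ∷ y₃ ∷ y₄ ∷ _ ∷ _ ∷ y₅ ∷ y₆ ∷ _ ∷ _ ∷ []) =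
  y₁ ∷ y₂ ∷ y₃ ∷ y₄ ∷ y₅ ∷ y₆ ∷ []
refoldG2 _ = []

RG2 : List ℤ → List ℤ
RG2 l = refoldG2 (applyMoves foldingMovesD4 (unfoldG2 l))

braidOrder : ℤ → ℤ → ℕ
braidOrder -[1+ 0 ] -[1+ 0 ] = 3
braidOrder -[1+ 1 ] -[1+ 0 ] = 4
braidOrder -[1+ 0 ] -[1+ 1 ] = 4
braidOrder -[1+ 2 ] -[1+ 0 ] = 6
braidOrder -[1+ 0 ] -[1+ 2 ] = 6
braidOrder _        _        = 2

-- relation between the Lusztig data n₁ (word i j i …) and n₂ (word j i j …)
-- of a rank 2 MV polygon, from (a_{ij}, a_{ji}).  (Type A1×A1: no condition.)
Transition : ℤ → ℤ → List ℤ → List ℤ → Set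
Transition -[1+ 0 ] -[1+ 0 ] n₁ n₂ = n₂ ≡ RA2 n₁
Transition -[1+ 1 ] -[1+ 0 ] n₁ n₂ = n₂ ≡ RB2 n₁
Transition -[1+ 0 ] -[1+ 1 ] n₁ n₂ = n₁ ≡ RB2 n₂
Transition -[1+ 2 ] -[1+ 0 ] n₁ n₂ = n₂ ≡ RG2 n₁
Transition -[1+ 0 ] -[1+ 2 ] n₁ n₂ = n₁ ≡ RG2 n₂
Transition _        _        n₁ n₂ = ⊤

alt : ∀ {r} → Fin r → Fin r → ℕ → Word r
alt i j zero    = []
alt i j (suc m) = i ∷ alt j i m

-- MV polytopes, via their vertex data (μ_v)_{v ∈ W}

module MV {r : ℕ} (C : CartanMatrix r) where
  open CartanMatrix C
  open Weyl C public

  record IsMVPolytope (μ : Word r → Coroot r) : Set where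
    field
      -- μ is a function on W
      wellDefined : ∀ u v → u ≈W v → μ u ≐ μ v
      edge        : ∀ w i → ∃[ n ] (μ (w ++ [ i ]) ≐ (μ w ⊕ (n ⊙ act w (simpleCoroot i))))
      -- tropical Plücker relations: on every 2-face w⟨s_i,s_j⟩ with
      -- w s_i > w and w s_j > w, the Lusztig data along the two sides
      -- are related by Lusztig's rank 2 transition map
      rank2       : ∀ w i j → i ≢ j → Reduced (w ++ [ i ]) → Reduced (w ++ [ j ]) →
                    ∀ n₁ n₂ →
                    LusztigAlong μ w (alt i j (braidOrder (a i j) (a j i))) n₁ →
                    LusztigAlong μ w (alt j i (braidOrder (a i j) (a j i))) n₂ →
                    Transition (a i j) (a j i) (map +_ n₁) (map +_ n₂)

  -- P ∈ 𝒫_w  :⇔  μ_w = μ_{w₀}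
  InP : (Word r → Coroot r) → Word r → Set
  InP μ w = ∀ u₀ → IsLongestWord u₀ → μ w ≐ μ u₀

  -- n_k = 0 for all k > ℓ(w), where ℓ(w) = length of the prefix u
  VanishAfter : Word r → List ℕ → Set
  VanishAfter u n = All (λ x → x ≡ 0) (drop (length u) n)

-- Along a reduced word i of w₀ the Lusztig datum records the edges μ_{w_k} - μ_{w_{k-1}} = n_k w_{k-1} α_{i_k}^∨,
-- and w_{k-1} α_{i_k}^∨ is a positive coroot because i is reduced.  So the height of μ grows by at least n_k at
-- step k, and if i starts with a reduced word of w, then μ_w = μ_{w₀} exactly when n_k = 0 for all k > ℓ(w).
-- That every reduced word of w extends to one of w₀, and that all words of w₀ give the same vertex, is Weyl
-- group theory for an arbitrary Cartan matrix of finite type: roots of reduced words are positive (by induction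
-- on length, through the rank two subsystems), lengths are bounded via a W-invariant positive definite form,
-- and a word with only descents is a reduced word of the unique longest element.
module Submission where

open import Defs
open import Data.Nat as ℕ using (ℕ; zero; suc; z≤n; s≤s)
import Data.Nat.Properties as ℕP
open import Data.Nat.ListAction using () renaming (sum to sumℕ)
open import Data.Integer as ℤ
  using (ℤ; +_; -[1+_]; +[1+_]; +0; 0ℤ; -1ℤ; _+_; _-_; _*_; -_; ∣_∣; _≤_; _<_; +≤+; -≤+; +<+)
import Data.Integer.Properties as ℤP
open import Data.Fin using (Fin; zero; suc; _≟_; toℕ; fromℕ<)
import Data.Fin.Properties as FinP
open import Data.Vec.Functional using (Vector; removeAt) renaming (_∷_ to _∷ᵥ_)
open import Data.List using (List; []; _∷_; _++_; [_]; length; reverse; map; drop; foldr)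
import Data.List.Properties as ListP
open import Data.List.Reverse using (Reverse; reverseView; []; _∶_∶ʳ_)
open import Data.List.Relation.Unary.All using (All; []; _∷_)
open import Data.Bool using (Bool; true; false; if_then_else_; not; T)
open import Data.Unit using (tt)
open import Data.Product using (Σ; ∃; ∃-syntax; _×_; _,_; proj₁; proj₂)
open import Data.Sum using (_⊎_; inj₁; inj₂)
open import Data.Bool.Properties using (T?)
open import Data.Empty using (⊥; ⊥-elim)
open import Relation.Nullary using (¬_; yes; no; Dec)
open import Relation.Nullary.Decidable using (_×-dec_; _⊎-dec_; _→-dec_; from-yes)
open import Relation.Binary.PropositionalEquality hiding ([_])
open import Relation.Binary.Bundles using (Setoid)
open import Function using (_∘_; case_of_)
open import Data.Integer.Solver using (module +-*-Solver)
open +-*-Solver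
open import Algebra.Properties.Semiring.Sum ℤP.+-*-semiring
  using (sum; sum-syntax; sum-cong-≗; sum-replicate-zero; ∑-distrib-+; ∑-comm; *-distribˡ-sum)
open import Algebra.Properties.CommutativeMonoid.Sum ℕP.*-1-commutativeMonoid
  using () renaming (sum to product; sum-remove to product-remove)

module IntegerFacts where

  0<i⇒0<i*j⇒0<j : ∀ {i} j → 0ℤ < i → 0ℤ < i * j → 0ℤ < j
  0<i⇒0<i*j⇒0<j {i} j 0<i 0<ij =
    ℤP.*-cancelˡ-<-nonNeg i ⦃ ℤ.nonNegative (ℤP.<⇒≤ 0<i) ⦄ (subst (_< i * j) (sym (ℤP.*-zeroʳ i)) 0<ij)

  i*j≢0 : ∀ {i j} → i ≢ 0ℤ → j ≢ 0ℤ → i * j ≢ 0ℤ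
  i*j≢0 {i} i≢0 j≢0 ij≡0 with ℤP.i*j≡0⇒i≡0∨j≡0 i ij≡0
  ... | inj₁ i≡0 = i≢0 i≡0
  ... | inj₂ j≡0 = j≢0 j≡0

  0≤i*j : ∀ {i j} → 0ℤ ≤ i → 0ℤ ≤ j → 0ℤ ≤ i * j
  0≤i*j {i} {j} 0≤i 0≤j = subst (_≤ i * j) (ℤP.*-zeroʳ i) (ℤP.*-monoˡ-≤-nonNeg i ⦃ ℤ.nonNegative 0≤i ⦄ 0≤j)

  i*j≤0 : ∀ {i j} → i ≤ 0ℤ → 0ℤ ≤ j → i * j ≤ 0ℤ
  i*j≤0 {i} {j} i≤0 0≤j = subst (i * j ≤_) (ℤP.*-zeroˡ j) (ℤP.*-monoʳ-≤-nonNeg j ⦃ ℤ.nonNegative 0≤j ⦄ i≤0)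

  i≤i+j : ∀ i {j} → 0ℤ ≤ j → i ≤ i + j
  i≤i+j i {j} 0≤j = ℤP.i≤i+j i j ⦃ ℤ.nonNegative 0≤j ⦄

  0<i⇒1≤i : ∀ {i} → 0ℤ < i → + 1 ≤ i
  0<i⇒1≤i = ℤP.i<j⇒suc[i]≤j

  0≤i+∣i∣ : ∀ i → 0ℤ ≤ i + + ∣ i ∣
  0≤i+∣i∣ (+ n)    = +≤+ z≤n
  0≤i+∣i∣ -[1+ n ] = ℤP.≤-reflexive (sym (ℤP.+-inverseˡ +[1+ n ]))

  +-cancelˡ-≤ : ∀ i {j k} → i + j ≤ i + k → j ≤ k
  +-cancelˡ-≤ i {j} {k} i+j≤i+k = subst₂ _≤_ (cancel j) (cancel k) (ℤP.+-monoʳ-≤ (- i) i+j≤i+k)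
    where
      cancel : ∀ x → - i + (i + x) ≡ x
      cancel x = solve 2 (λ i x → :- i :+ (i :+ x) := x) refl i x

open IntegerFacts

module FiniteSums where

  sumFin≡sum : ∀ {n} (f : Vector ℤ n) → sumFin f ≡ sum f
  sumFin≡sum {zero}  f = refl
  sumFin≡sum {suc n} f = cong (_+_ (f zero)) (sumFin≡sum (f ∘ suc))

  sum-*ˡ : ∀ {n} c (f : Vector ℤ n) → ∑[ k < n ] (c * f k) ≡ c * sum f
  sum-*ˡ c f = sym (*-distribˡ-sum c f)

  sum-*ʳ : ∀ {n} c (f : Vector ℤ n) → ∑[ k < n ] (f k * c) ≡ sum f * c
  sum-*ʳ c f = trans (sum-cong-≗ (λ k → ℤP.*-comm (f k) c)) (trans (sum-*ˡ c f) (ℤP.*-comm c _))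

  sum-simpleCoroot : ∀ {n} i (f : Vector ℤ n) → ∑[ k < n ] (simpleCoroot i k * f k) ≡ f i
  sum-simpleCoroot {suc n} zero    f =
    trans (cong (_+_ (+ 1 * f zero)) (trans (sum-cong-≗ (λ k → ℤP.*-zeroˡ (f (suc k)))) (sum-replicate-zero n)))
          (trans (ℤP.+-identityʳ _) (ℤP.*-identityˡ (f zero)))
  sum-simpleCoroot {suc n} (suc i) f =
    trans (cong (_+_ (0ℤ * f zero)) (sum-simpleCoroot i (f ∘ suc))) (ℤP.+-identityˡ (f (suc i)))

  sum-nonNeg : ∀ {n} (f : Vector ℤ n) → (∀ k → 0ℤ ≤ f k) → 0ℤ ≤ sum f
  sum-nonNeg {zero}  f 0≤f = ℤP.≤-refl
  sum-nonNeg {suc n} f 0≤f = ℤP.+-mono-≤ (0≤f zero) (sum-nonNeg (f ∘ suc) (0≤f ∘ suc))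

  term≤sum : ∀ {n} (f : Vector ℤ n) → (∀ k → 0ℤ ≤ f k) → ∀ i → f i ≤ sum f
  term≤sum {suc n} f 0≤f zero    = i≤i+j (f zero) (sum-nonNeg (f ∘ suc) (0≤f ∘ suc))
  term≤sum {suc n} f 0≤f (suc i) = ℤP.≤-trans (term≤sum (f ∘ suc) (0≤f ∘ suc) i)
    (subst (_≤ f zero + sum (f ∘ suc)) (ℤP.+-identityˡ _) (ℤP.+-monoˡ-≤ (sum (f ∘ suc)) (0≤f zero)))

  0<xᵢ+[1+∑∣x∣]*v : ∀ {n} (x : Vector ℤ n) i {v} → + 1 ≤ v → 0ℤ < x i + (+ 1 + ∑[ j < n ] (+ ∣ x j ∣)) * v
  0<xᵢ+[1+∑∣x∣]*v {n} x i {v} 1≤v = subst (0ℤ <_) rearranged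
    (ℤP.<-≤-trans (+<+ (s≤s z≤n)) (i≤i+j (+ 1) (ℤP.+-mono-≤ (ℤP.+-mono-≤ (0≤i+∣i∣ (x i)) 0≤A-∣xᵢ∣) 0≤N[v-1])))
    where
      A = ∑[ j < n ] (+ ∣ x j ∣)
      0≤A-∣xᵢ∣ : 0ℤ ≤ A - + ∣ x i ∣
      0≤A-∣xᵢ∣ = ℤP.i≤j⇒0≤j-i (term≤sum (λ j → + ∣ x j ∣) (λ j → +≤+ z≤n) i)
      0≤N[v-1] : 0ℤ ≤ (+ 1 + A) * (v - + 1)
      0≤N[v-1] = 0≤i*j (ℤP.+-mono-≤ (+≤+ z≤n) (sum-nonNeg (λ j → + ∣ x j ∣) (λ j → +≤+ z≤n))) (ℤP.i≤j⇒0≤j-i 1≤v)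
      rearranged : + 1 + ((x i + + ∣ x i ∣) + (A - + ∣ x i ∣) + (+ 1 + A) * (v - + 1)) ≡ x i + (+ 1 + A) * v
      rearranged = solve 4 (λ xi a A v → con (+ 1) :+ ((xi :+ a) :+ (A :- a) :+ (con (+ 1) :+ A) :* (v :- con (+ 1))) := xi :+ (con (+ 1) :+ A) :* v)
                           refl (x i) (+ ∣ x i ∣) A v

  productExcept : ∀ {n} → Vector ℕ n → Fin n → ℕ
  productExcept {suc n} f l = product (removeAt f l)

  *-productExcept : ∀ {n} (f : Vector ℕ n) l → f l ℕ.* productExcept f l ≡ product f
  *-productExcept {suc n} f l = sym (product-remove f)

  product-positive : ∀ {n} (f : Vector ℕ n) → (∀ k → 0 ℕ.< f k) → 0 ℕ.< product f
  product-positive {zero}  f f>0 = s≤s z≤n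
  product-positive {suc n} f f>0 = ℕP.*-mono-≤ (f>0 zero) (product-positive (f ∘ suc) (f>0 ∘ suc))

open FiniteSums

module IntegerMatrices where

  Matrix : ℕ → Set
  Matrix n = Fin n → Fin n → ℤ

  infixr 7 _*ᵥ_

  _*ᵥ_ : ∀ {n} → Matrix n → Vector ℤ n → Vector ℤ n
  (M *ᵥ y) i = ∑[ j < _ ] (M i j * y j)

  quadratic : ∀ {n} → Matrix n → Vector ℤ n → ℤ
  quadratic M x = ∑[ i < _ ] (x i * (M *ᵥ x) i)

  Symmetric : ∀ {n} → Matrix n → Set
  Symmetric M = ∀ i j → M i j ≡ M j i

  PositiveDefinite : ∀ {n} → Matrix n → Set
  PositiveDefinite M = ∀ x k → x k ≢ 0ℤ → 0ℤ < quadratic M x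

  *ᵥ-scale : ∀ {n} (M : Matrix n) c x i → (M *ᵥ (λ j → c * x j)) i ≡ c * (M *ᵥ x) i
  *ᵥ-scale M c x i = trans (sum-cong-≗ (λ j → solve 3 (λ m c x → m :* (c :* x) := c :* (m :* x)) refl (M i j) c (x j)))
                           (sum-*ˡ c (λ j → M i j * x j))

  quadratic-scale : ∀ {n} (M : Matrix n) c x → quadratic M (λ j → c * x j) ≡ c * c * quadratic M x
  quadratic-scale M c x =
    trans (sum-cong-≗ (λ i → trans (cong (c * x i *_) (*ᵥ-scale M c x i))
            (solve 3 (λ c x r → c :* x :* (c :* r) := c :* c :* (x :* r)) refl c (x i) ((M *ᵥ x) i))))
          (sum-*ˡ (c * c) (λ i → x i * (M *ᵥ x) i))

  -- Splitting M = [[m₀₀, lᵀ], [l, M′]], the Schur complement of the corner, scaled by m₀₀ to stay integral.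
  module SchurComplement {n} (M : Matrix (suc n)) (M-sym : Symmetric M) where

    m₀₀ : ℤ
    m₀₀ = M zero zero

    l : Vector ℤ n
    l i = M zero (suc i)

    M′ : Matrix n
    M′ i j = M (suc i) (suc j)

    schur : Matrix n
    schur i j = m₀₀ * M′ i j - l i * l j

    l· : Vector ℤ n → ℤ
    l· x = ∑[ j < n ] (l j * x j)

    schur-symmetric : Symmetric schur
    schur-symmetric i j = cong₂ (λ u v → m₀₀ * u - v) (M-sym (suc i) (suc j)) (ℤP.*-comm (l i) (l j))

    l·-scale : ∀ c x → l· (λ j → c * x j) ≡ c * l· x
    l·-scale c x = trans (sum-cong-≗ (λ j → solve 3 (λ m c x → m :* (c :* x) := c :* (m :* x)) refl (l j) c (x j)))
                         (sum-*ˡ c (λ j → l j * x j))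

    *ᵥ-∷-suc : ∀ y₀ y i → (M *ᵥ (y₀ ∷ᵥ y)) (suc i) ≡ l i * y₀ + (M′ *ᵥ y) i
    *ᵥ-∷-suc y₀ y i = cong (λ u → u * y₀ + (M′ *ᵥ y) i) (M-sym (suc i) zero)

    schur-*ᵥ : ∀ y i → (schur *ᵥ y) i ≡ m₀₀ * (M′ *ᵥ y) i - l i * l· y
    schur-*ᵥ y i =
      trans (sum-cong-≗ (λ j → solve 5 (λ S m li lj y → (S :* m :- li :* lj) :* y := S :* (m :* y) :+ (:- li) :* (lj :* y))
                                        refl m₀₀ (M′ i j) (l i) (l j) (y j)))
     (trans (∑-distrib-+ (λ j → m₀₀ * (M′ i j * y j)) (λ j → (- l i) * (l j * y j)))
     (trans (cong₂ _+_ (sum-*ˡ m₀₀ (λ j → M′ i j * y j)) (sum-*ˡ (- l i) (λ j → l j * y j)))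
            (solve 4 (λ S R li Ly → S :* R :+ (:- li) :* Ly := S :* R :- li :* Ly) refl m₀₀ ((M′ *ᵥ y) i) (l i) (l· y))))

    quadratic-∷ : ∀ y₀ y → quadratic M (y₀ ∷ᵥ y) ≡ y₀ * (m₀₀ * y₀ + l· y) + y₀ * l· y + quadratic M′ y
    quadratic-∷ y₀ y =
      trans (cong (_+_ (y₀ * (m₀₀ * y₀ + l· y)))
              (trans (sum-cong-≗ (λ i → trans (cong (y i *_) (*ᵥ-∷-suc y₀ y i))
                       (solve 4 (λ yi li y0 R → yi :* (li :* y0 :+ R) := y0 :* (li :* yi) :+ yi :* R) refl (y i) (l i) y₀ ((M′ *ᵥ y) i))))
              (trans (∑-distrib-+ (λ i → y₀ * (l i * y i)) (λ i → y i * (M′ *ᵥ y) i))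
                     (cong (_+ quadratic M′ y) (sum-*ˡ y₀ (λ i → l i * y i))))))
            (sym (ℤP.+-assoc (y₀ * (m₀₀ * y₀ + l· y)) (y₀ * l· y) (quadratic M′ y)))

    quadratic-schur : ∀ y → quadratic schur y ≡ m₀₀ * quadratic M′ y - l· y * l· y
    quadratic-schur y =
      trans (sum-cong-≗ (λ i → trans (cong (y i *_) (schur-*ᵥ y i))
              (solve 5 (λ yi S R li Ly → yi :* (S :* R :- li :* Ly) := S :* (yi :* R) :+ (:- Ly) :* (li :* yi))
                       refl (y i) m₀₀ ((M′ *ᵥ y) i) (l i) (l· y))))
     (trans (∑-distrib-+ (λ i → m₀₀ * (y i * (M′ *ᵥ y) i)) (λ i → (- l· y) * (l i * y i)))
     (trans (cong₂ _+_ (sum-*ˡ m₀₀ (λ i → y i * (M′ *ᵥ y) i)) (sum-*ˡ (- l· y) (λ i → l i * y i)))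
            (solve 3 (λ S Q Ly → S :* Q :+ (:- Ly) :* Ly := S :* Q :- Ly :* Ly) refl m₀₀ (quadratic M′ y) (l· y))))

    quadratic-completion : ∀ x → quadratic M ((- l· x) ∷ᵥ (λ j → m₀₀ * x j)) ≡ m₀₀ * quadratic schur x
    quadratic-completion x = begin
      quadratic M ((- l· x) ∷ᵥ (λ j → m₀₀ * x j))
        ≡⟨ quadratic-∷ (- l· x) (λ j → m₀₀ * x j) ⟩
      (- l· x) * (m₀₀ * (- l· x) + l· (λ j → m₀₀ * x j)) + (- l· x) * l· (λ j → m₀₀ * x j) + quadratic M′ (λ j → m₀₀ * x j)
        ≡⟨ cong₂ (λ u v → (- l· x) * (m₀₀ * (- l· x) + u) + (- l· x) * u + v) (l·-scale m₀₀ x) (quadratic-scale M′ m₀₀ x) ⟩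
      (- l· x) * (m₀₀ * (- l· x) + m₀₀ * l· x) + (- l· x) * (m₀₀ * l· x) + m₀₀ * m₀₀ * quadratic M′ x
        ≡⟨ solve 3 (λ L S Q → (:- L) :* (S :* (:- L) :+ S :* L) :+ (:- L) :* (S :* L) :+ S :* S :* Q := S :* (S :* Q :- L :* L))
                   refl (l· x) m₀₀ (quadratic M′ x) ⟩
      m₀₀ * (m₀₀ * quadratic M′ x - l· x * l· x)
        ≡⟨ cong (m₀₀ *_) (sym (quadratic-schur x)) ⟩
      m₀₀ * quadratic schur x ∎
      where open ≡-Reasoning

    module _ (M-pd : PositiveDefinite M) where

      m₀₀-positive : 0ℤ < m₀₀
      m₀₀-positive = subst (0ℤ <_) corner (M-pd (+ 1 ∷ᵥ (λ _ → 0ℤ)) zero (λ ()))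
        where
          corner : quadratic M (+ 1 ∷ᵥ (λ _ → 0ℤ)) ≡ m₀₀
          corner = trans (quadratic-∷ (+ 1) (λ _ → 0ℤ))
            (trans (cong₂ (λ u v → + 1 * (m₀₀ * + 1 + u) + + 1 * u + v)
                     (trans (sum-cong-≗ (λ j → ℤP.*-zeroʳ (l j))) (sum-replicate-zero n))
                     (trans (sum-cong-≗ (λ i → ℤP.*-zeroˡ ((M′ *ᵥ (λ _ → 0ℤ)) i))) (sum-replicate-zero n)))
                   (solve 1 (λ S → con (+ 1) :* (S :* con (+ 1) :+ con 0ℤ) :+ con (+ 1) :* con 0ℤ :+ con 0ℤ := S) refl m₀₀))

      schur-positiveDefinite : PositiveDefinite schur
      schur-positiveDefinite x k xₖ≢0 =
        0<i⇒0<i*j⇒0<j (quadratic schur x) m₀₀-positive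
          (subst (0ℤ <_) (quadratic-completion x)
                 (M-pd ((- l· x) ∷ᵥ (λ j → m₀₀ * x j)) (suc k) (i*j≢0 {m₀₀} (λ m₀₀≡0 → ℤP.<-irrefl (sym m₀₀≡0) m₀₀-positive) xₖ≢0)))

  dominant : ∀ {n} (M : Matrix n) → Symmetric M → PositiveDefinite M →
             ∃[ y ] (∀ i → 0ℤ < (M *ᵥ y) i)
  dominant {zero}  M M-sym M-pd = (λ ()) , (λ ())
  dominant {suc n} M M-sym M-pd = y , positive
    where
      open SchurComplement M M-sym
      open ≡-Reasoning
      ih = dominant schur schur-symmetric (schur-positiveDefinite M-pd)
      y′ = proj₁ ih
      -- N exceeds every ∣ l i ∣, so N times a positive entry of schur *ᵥ y′ dominates l i.
      N : ℤ
      N = + 1 + ∑[ i < n ] (+ ∣ l i ∣)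
      y : Vector ℤ (suc n)
      y = (+ 1 - N * l· y′) ∷ᵥ (λ j → (N * m₀₀) * y′ j)
      positive : ∀ i → 0ℤ < (M *ᵥ y) i
      positive zero = subst (0ℤ <_) (sym row₀) (m₀₀-positive M-pd)
        where
          row₀ : (M *ᵥ y) zero ≡ m₀₀
          row₀ = trans (cong (λ u → m₀₀ * (+ 1 - N * l· y′) + u) (l·-scale (N * m₀₀) y′))
                       (solve 3 (λ S N L → S :* (con (+ 1) :- N :* L) :+ (N :* S) :* L := S) refl m₀₀ N (l· y′))
      positive (suc i) = subst (0ℤ <_) (sym rowᵢ) (0<xᵢ+[1+∑∣x∣]*v l i (0<i⇒1≤i (proj₂ ih i)))
        where
          v = (schur *ᵥ y′) i
          rowᵢ : (M *ᵥ y) (suc i) ≡ l i + N * v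
          rowᵢ = begin
            (M *ᵥ y) (suc i)                                     ≡⟨ *ᵥ-∷-suc _ _ i ⟩
            l i * (+ 1 - N * l· y′) + (M′ *ᵥ (λ j → (N * m₀₀) * y′ j)) i ≡⟨ cong (_+_ (l i * (+ 1 - N * l· y′))) (*ᵥ-scale M′ (N * m₀₀) y′ i) ⟩
            l i * (+ 1 - N * l· y′) + (N * m₀₀) * (M′ *ᵥ y′) i     ≡⟨ solve 5 (λ li N L S R → li :* (con (+ 1) :- N :* L) :+ (N :* S) :* R
                                                                                      := li :+ N :* (S :* R :- li :* L)) refl (l i) N (l· y′) m₀₀ ((M′ *ᵥ y′) i) ⟩
            l i + N * (m₀₀ * (M′ *ᵥ y′) i - l i * l· y′)          ≡⟨ cong (λ u → l i + N * u) (sym (schur-*ᵥ y′ i)) ⟩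
            l i + N * v ∎

open IntegerMatrices

module Reflections {r : ℕ} (C : CartanMatrix r) where

  open CartanMatrix C public
  open MV C public

  α : Fin r → Coroot r
  α = simpleCoroot

  infixr 7 _·_

  _·_ : ℤ → Coroot r → Coroot r
  (c · x) k = c * x k

  0ᶜ : Coroot r
  0ᶜ k = 0ℤ

  ≐-setoid : Setoid _ _
  ≐-setoid = Fin r →-setoid ℤ

  open Setoid ≐-setoid public using () renaming (refl to ≐-refl; sym to ≐-sym; trans to ≐-trans)

  α-self : ∀ i → α i i ≡ + 1
  α-self i with i ≟ i
  ... | yes _  = refl
  ... | no i≢i = ⊥-elim (i≢i refl)

  α-off : ∀ i j → j ≢ i → α i j ≡ 0ℤ
  α-off i j j≢i with j ≟ i
  ... | yes j≡i = ⊥-elim (j≢i j≡i)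
  ... | no _    = refl

  pairRoot-sum : ∀ x i → pairRoot x i ≡ ∑[ k < r ] (x k * a k i)
  pairRoot-sum x i = sumFin≡sum (λ k → x k * a k i)

  pairRoot-cong : ∀ {x y} i → x ≐ y → pairRoot x i ≡ pairRoot y i
  pairRoot-cong {x} {y} i x≐y =
    trans (pairRoot-sum x i) (trans (sum-cong-≗ (λ k → cong (_* a k i) (x≐y k))) (sym (pairRoot-sum y i)))

  pairRoot-⊕ : ∀ x y i → pairRoot (x ⊕ y) i ≡ pairRoot x i + pairRoot y i
  pairRoot-⊕ x y i = begin
    pairRoot (x ⊕ y) i                               ≡⟨ pairRoot-sum (x ⊕ y) i ⟩
    ∑[ k < r ] ((x k + y k) * a k i)                 ≡⟨ sum-cong-≗ (λ k → ℤP.*-distribʳ-+ (a k i) (x k) (y k)) ⟩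
    ∑[ k < r ] (x k * a k i + y k * a k i)           ≡⟨ ∑-distrib-+ (λ k → x k * a k i) (λ k → y k * a k i) ⟩
    ∑[ k < r ] (x k * a k i) + ∑[ k < r ] (y k * a k i) ≡⟨ sym (cong₂ _+_ (pairRoot-sum x i) (pairRoot-sum y i)) ⟩
    pairRoot x i + pairRoot y i ∎
    where open ≡-Reasoning

  pairRoot-· : ∀ c x i → pairRoot (c · x) i ≡ c * pairRoot x i
  pairRoot-· c x i = begin
    pairRoot (c · x) i               ≡⟨ pairRoot-sum (c · x) i ⟩
    ∑[ k < r ] (c * x k * a k i)     ≡⟨ sum-cong-≗ (λ k → ℤP.*-assoc c (x k) (a k i)) ⟩
    ∑[ k < r ] (c * (x k * a k i))   ≡⟨ sum-*ˡ c (λ k → x k * a k i) ⟩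
    c * ∑[ k < r ] (x k * a k i)     ≡⟨ cong (c *_) (sym (pairRoot-sum x i)) ⟩
    c * pairRoot x i ∎
    where open ≡-Reasoning

  pairRoot-α : ∀ j i → pairRoot (α j) i ≡ a j i
  pairRoot-α j i = trans (pairRoot-sum (α j) i) (sum-simpleCoroot j (λ k → a k i))

  pairRoot-0ᶜ : ∀ i → pairRoot 0ᶜ i ≡ 0ℤ
  pairRoot-0ᶜ i = trans (pairRoot-sum 0ᶜ i) (trans (sum-cong-≗ (λ k → ℤP.*-zeroˡ (a k i))) (sum-replicate-zero r))

  refl-s-apply : ∀ i x k → refl-s i x k ≡ x k - pairRoot x i * α i k
  refl-s-apply i x k with k ≟ i
  ... | yes _ = cong (_-_ (x k)) (sym (ℤP.*-identityʳ (pairRoot x i)))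
  ... | no _  = solve 2 (λ a b → a := a :- b :* con 0ℤ) refl (x k) (pairRoot x i)

  refl-s-⊕· : ∀ i x → refl-s i x ≐ (x ⊕ ((- pairRoot x i) · α i))
  refl-s-⊕· i x k = trans (refl-s-apply i x k) (cong (_+_ (x k)) (ℤP.neg-distribˡ-* (pairRoot x i) (α i k)))

  refl-s-off : ∀ i x j → j ≢ i → refl-s i x j ≡ x j
  refl-s-off i x j j≢i with j ≟ i
  ... | yes j≡i = ⊥-elim (j≢i j≡i)
  ... | no _    = refl

  refl-s-cong : ∀ i {x y} → x ≐ y → refl-s i x ≐ refl-s i y
  refl-s-cong i {x} {y} x≐y k =
    trans (refl-s-apply i x k)
          (trans (cong₂ (λ u v → u - v * α i k) (x≐y k) (pairRoot-cong i x≐y)) (sym (refl-s-apply i y k)))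

  refl-s-⊕ : ∀ i x y → refl-s i (x ⊕ y) ≐ (refl-s i x ⊕ refl-s i y)
  refl-s-⊕ i x y k = begin
    refl-s i (x ⊕ y) k                                       ≡⟨ refl-s-apply i (x ⊕ y) k ⟩
    (x k + y k) - pairRoot (x ⊕ y) i * α i k                  ≡⟨ cong (λ p → (x k + y k) - p * α i k) (pairRoot-⊕ x y i) ⟩
    (x k + y k) - (pairRoot x i + pairRoot y i) * α i k       ≡⟨ solve 5 (λ X Y P Q E → (X :+ Y) :- (P :+ Q) :* E := (X :- P :* E) :+ (Y :- Q :* E))
                                                                         refl (x k) (y k) (pairRoot x i) (pairRoot y i) (α i k) ⟩
    (x k - pairRoot x i * α i k) + (y k - pairRoot y i * α i k) ≡⟨ sym (cong₂ _+_ (refl-s-apply i x k) (refl-s-apply i y k)) ⟩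
    refl-s i x k + refl-s i y k ∎
    where open ≡-Reasoning

  refl-s-· : ∀ i c x → refl-s i (c · x) ≐ (c · refl-s i x)
  refl-s-· i c x k = begin
    refl-s i (c · x) k                      ≡⟨ refl-s-apply i (c · x) k ⟩
    c * x k - pairRoot (c · x) i * α i k    ≡⟨ cong (λ p → c * x k - p * α i k) (pairRoot-· c x i) ⟩
    c * x k - (c * pairRoot x i) * α i k    ≡⟨ solve 4 (λ C X P E → C :* X :- (C :* P) :* E := C :* (X :- P :* E)) refl c (x k) (pairRoot x i) (α i k) ⟩
    c * (x k - pairRoot x i * α i k)        ≡⟨ cong (c *_) (sym (refl-s-apply i x k)) ⟩
    c * refl-s i x k ∎
    where open ≡-Reasoning

  refl-s-0ᶜ : ∀ i → refl-s i 0ᶜ ≐ 0ᶜ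
  refl-s-0ᶜ i k = trans (refl-s-apply i 0ᶜ k)
    (trans (cong (λ p → 0ℤ - p * α i k) (pairRoot-0ᶜ i)) (solve 1 (λ E → con 0ℤ :- con 0ℤ :* E := con 0ℤ) refl (α i k)))

  pairRoot-refl-s : ∀ i x j → pairRoot (refl-s i x) j ≡ pairRoot x j - pairRoot x i * a i j
  pairRoot-refl-s i x j = begin
    pairRoot (refl-s i x) j                               ≡⟨ pairRoot-cong j (refl-s-⊕· i x) ⟩
    pairRoot (x ⊕ ((- pairRoot x i) · α i)) j             ≡⟨ pairRoot-⊕ x _ j ⟩
    pairRoot x j + pairRoot ((- pairRoot x i) · α i) j    ≡⟨ cong (_+_ (pairRoot x j)) (trans (pairRoot-· (- pairRoot x i) (α i) j)
                                                                                                (cong ((- pairRoot x i) *_) (pairRoot-α i j))) ⟩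
    pairRoot x j + (- pairRoot x i) * a i j               ≡⟨ solve 3 (λ X P A → X :+ (:- P) :* A := X :- P :* A) refl (pairRoot x j) (pairRoot x i) (a i j) ⟩
    pairRoot x j - pairRoot x i * a i j ∎
    where open ≡-Reasoning

  refl-s-involutive : ∀ i x → refl-s i (refl-s i x) ≐ x
  refl-s-involutive i x k = begin
    refl-s i (refl-s i x) k                                         ≡⟨ refl-s-apply i (refl-s i x) k ⟩
    refl-s i x k - pairRoot (refl-s i x) i * α i k                  ≡⟨ cong₂ (λ u v → u - v * α i k) (refl-s-apply i x k)
                                                                        (trans (pairRoot-refl-s i x i) (cong (λ z → pairRoot x i - pairRoot x i * z) (a-diag i))) ⟩
    (x k - p * α i k) - (p - p * + 2) * α i k                        ≡⟨ solve 3 (λ X P E → (X :- P :* E) :- (P :- P :* con (+ 2)) :* E := X) refl (x k) p (α i k) ⟩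
    x k ∎
    where
      open ≡-Reasoning
      p = pairRoot x i

  refl-s-α : ∀ i → refl-s i (α i) ≐ (-1ℤ · α i)
  refl-s-α i k = trans (refl-s-apply i (α i) k)
    (trans (cong (λ p → α i k - p * α i k) (trans (pairRoot-α i i) (a-diag i)))
           (solve 1 (λ E → E :- con (+ 2) :* E := con -1ℤ :* E) refl (α i k)))

  act-cong : ∀ u {x y} → x ≐ y → act u x ≐ act u y
  act-cong []      x≐y = x≐y
  act-cong (i ∷ u) x≐y = refl-s-cong i (act-cong u x≐y)

  act-⊕ : ∀ u x y → act u (x ⊕ y) ≐ (act u x ⊕ act u y)
  act-⊕ []      x y = ≐-refl
  act-⊕ (i ∷ u) x y = ≐-trans (refl-s-cong i (act-⊕ u x y)) (refl-s-⊕ i _ _)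

  act-· : ∀ u c x → act u (c · x) ≐ (c · act u x)
  act-· []      c x = ≐-refl
  act-· (i ∷ u) c x = ≐-trans (refl-s-cong i (act-· u c x)) (refl-s-· i c _)

  act-0ᶜ : ∀ u → act u 0ᶜ ≐ 0ᶜ
  act-0ᶜ []      = ≐-refl
  act-0ᶜ (i ∷ u) = ≐-trans (refl-s-cong i (act-0ᶜ u)) (refl-s-0ᶜ i)

  act-++ : ∀ u v x → act (u ++ v) x ≡ act u (act v x)
  act-++ []      v x = refl
  act-++ (i ∷ u) v x = cong (refl-s i) (act-++ u v x)

  act-reverse-act : ∀ u x → act (reverse u) (act u x) ≐ x
  act-reverse-act []      x = ≐-refl
  act-reverse-act (i ∷ u) x rewrite ListP.unfold-reverse i u | act-++ (reverse u) [ i ] (refl-s i (act u x)) =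
    ≐-trans (act-cong (reverse u) (refl-s-involutive i (act u x))) (act-reverse-act u x)

module Words {r : ℕ} (C : CartanMatrix r) where

  open Reflections C public

  ≈W-refl : ∀ {u} → u ≈W u
  ≈W-refl x = ≐-refl

  ≈W-sym : ∀ {u v} → u ≈W v → v ≈W u
  ≈W-sym u≈v x = ≐-sym (u≈v x)

  ≈W-trans : ∀ {u v w} → u ≈W v → v ≈W w → u ≈W w
  ≈W-trans u≈v v≈w x = ≐-trans (u≈v x) (v≈w x)

  ++⁺ˡ-≈W : ∀ p {u v} → u ≈W v → (p ++ u) ≈W (p ++ v)
  ++⁺ˡ-≈W p {u} {v} u≈v x rewrite act-++ p u x | act-++ p v x = act-cong p (u≈v x)

  ++⁺ʳ-≈W : ∀ q {u v} → u ≈W v → (u ++ q) ≈W (v ++ q)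
  ++⁺ʳ-≈W q {u} {v} u≈v x rewrite act-++ u q x | act-++ v q x = u≈v (act q x)

  cancel-ss : ∀ u s w → ((u ++ [ s ]) ++ s ∷ w) ≈W (u ++ w)
  cancel-ss u s w x rewrite act-++ (u ++ [ s ]) (s ∷ w) x | act-++ u [ s ] (refl-s s (act w x)) | act-++ u w x =
    act-cong u (refl-s-involutive s (act w x))

  cancel-ss-end : ∀ u s → ((u ++ [ s ]) ++ [ s ]) ≈W u
  cancel-ss-end u s = subst (λ v → ((u ++ [ s ]) ++ [ s ]) ≈W v) (ListP.++-identityʳ u) (cancel-ss u s [])

  length-snoc : ∀ (u : Word r) i → length (u ++ [ i ]) ≡ suc (length u)
  length-snoc u i = trans (ListP.length-++ u) (ℕP.+-comm (length u) 1)

  Reduced-[] : Reduced []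
  Reduced-[] v _ = z≤n

  Reduced-++⁻ˡ : ∀ u v → Reduced (u ++ v) → Reduced u
  Reduced-++⁻ˡ u v uv-red w u≈w = ℕP.+-cancelʳ-≤ (length v) (length u) (length w)
    (subst₂ ℕ._≤_ (ListP.length-++ u) (ListP.length-++ w) (uv-red (w ++ v) (++⁺ʳ-≈W v {u} {w} u≈w)))

  Reduced-++⁻ʳ : ∀ u v → Reduced (u ++ v) → Reduced v
  Reduced-++⁻ʳ u v uv-red w v≈w = ℕP.+-cancelˡ-≤ (length u) (length v) (length w)
    (subst₂ ℕ._≤_ (ListP.length-++ u) (ListP.length-++ u) (uv-red (u ++ w) (++⁺ˡ-≈W u {v} {w} v≈w)))

  Reduced-resp : ∀ {u v} → Reduced u → u ≈W v → length v ℕ.≤ length u → Reduced v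
  Reduced-resp {u} {v} u-red u≈v ∣v∣≤∣u∣ w v≈w = ℕP.≤-trans ∣v∣≤∣u∣ (u-red w (≈W-trans {u} {v} {w} u≈v v≈w))

  ¬Reduced-ss : ∀ p i q → ¬ Reduced (p ++ i ∷ i ∷ q)
  ¬Reduced-ss p i q red = ℕP.<-irrefl refl (ℕP.≤-trans shorter (red (p ++ q) (++⁺ˡ-≈W p {i ∷ i ∷ q} {q} (λ x → refl-s-involutive i (act q x)))))
    where
      shorter : suc (length (p ++ q)) ℕ.≤ length (p ++ i ∷ i ∷ q)
      shorter rewrite ListP.length-++ p {q} | ListP.length-++ p {i ∷ i ∷ q}
                    | ℕP.+-suc (length p) (suc (length q)) | ℕP.+-suc (length p) (length q) = ℕP.n≤1+n _

  root : Word r → Fin r → Coroot r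
  root w s = act w (α s)

  Nonneg : Coroot r → Set
  Nonneg x = ∀ k → 0ℤ ≤ x k

  Nonpos : Coroot r → Set
  Nonpos x = ∀ k → x k ≤ 0ℤ

  Coherent : Coroot r → Set
  Coherent x = Nonneg x ⊎ Nonpos x

  nonneg? : ∀ x → Dec (Nonneg x)
  nonneg? x = FinP.all? (λ k → 0ℤ ℤ.≤? x k)

  ∃-≢0 : ∀ x → ¬ (x ≐ 0ᶜ) → ∃[ k ] (x k ≢ 0ℤ)
  ∃-≢0 x x≢0 = FinP.¬∀⟶∃¬ r (λ k → x k ≡ 0ℤ) (λ k → x k ℤP.≟ 0ℤ) x≢0

  α-Nonneg : ∀ s → Nonneg (α s)
  α-Nonneg s k with k ≟ s
  ... | yes _ = +≤+ z≤n
  ... | no _  = +≤+ z≤n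

  Nonneg-resp : ∀ {x y} → x ≐ y → Nonneg x → Nonneg y
  Nonneg-resp x≐y x≥0 k = subst (0ℤ ≤_) (x≐y k) (x≥0 k)

  Nonpos-resp : ∀ {x y} → x ≐ y → Nonpos x → Nonpos y
  Nonpos-resp x≐y x≤0 k = subst (_≤ 0ℤ) (x≐y k) (x≤0 k)

  Coherent-resp : ∀ {x y} → x ≐ y → Coherent x → Coherent y
  Coherent-resp x≐y (inj₁ x≥0) = inj₁ (Nonneg-resp x≐y x≥0)
  Coherent-resp x≐y (inj₂ x≤0) = inj₂ (Nonpos-resp x≐y x≤0)

  neg-Nonneg : ∀ {x} → Nonneg x → Nonpos (-1ℤ · x)
  neg-Nonneg {x} x≥0 k = subst (_≤ 0ℤ) (sym (ℤP.-1*i≡-i (x k))) (ℤP.neg-mono-≤ (x≥0 k))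

  neg-Nonpos : ∀ {x} → Nonpos x → Nonneg (-1ℤ · x)
  neg-Nonpos {x} x≤0 k = subst (0ℤ ≤_) (sym (ℤP.-1*i≡-i (x k))) (ℤP.neg-mono-≤ (x≤0 k))

  neg-neg : ∀ x → (-1ℤ · (-1ℤ · x)) ≐ x
  neg-neg x k = solve 1 (λ X → con -1ℤ :* (con -1ℤ :* X) := X) refl (x k)

  neg-Nonneg⁻¹ : ∀ {x} → Nonneg (-1ℤ · x) → Nonpos x
  neg-Nonneg⁻¹ {x} -x≥0 = Nonpos-resp (neg-neg x) (neg-Nonneg -x≥0)

  neg-Coherent : ∀ {x} → Coherent x → Coherent (-1ℤ · x)
  neg-Coherent (inj₁ x≥0) = inj₂ (neg-Nonneg x≥0)
  neg-Coherent (inj₂ x≤0) = inj₁ (neg-Nonpos x≤0)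

  root≢0 : ∀ w s → ¬ (root w s ≐ 0ᶜ)
  root≢0 w s root≐0 = 1≢0 (begin
    + 1                                    ≡⟨ sym (α-self s) ⟩
    α s s                                  ≡⟨ sym (act-reverse-act w (α s) s) ⟩
    act (reverse w) (root w s) s           ≡⟨ act-cong (reverse w) root≐0 s ⟩
    act (reverse w) 0ᶜ s                   ≡⟨ act-0ᶜ (reverse w) s ⟩
    0ℤ ∎)
    where
      open ≡-Reasoning
      1≢0 : + 1 ≢ 0ℤ
      1≢0 ()

  ¬Nonneg×Nonpos : ∀ w s → Nonneg (root w s) → Nonpos (root w s) → ⊥
  ¬Nonneg×Nonpos w s ≥0 ≤0 = root≢0 w s (λ k → ℤP.≤-antisym (≤0 k) (≥0 k))

  root-snoc-self : ∀ w s → root (w ++ [ s ]) s ≐ (-1ℤ · root w s)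
  root-snoc-self w s k rewrite act-++ w [ s ] (α s) = ≐-trans (act-cong w (refl-s-α s)) (act-· w -1ℤ (α s)) k

-- The W-invariant form on the coroot lattice: ⟪ α k , α l ⟫ = a k l * ε l, where ε l = ∏_{m ≠ l} d m
-- makes the Gram matrix symmetric with integer entries.
module InvariantForm {r : ℕ} (C : CartanMatrix r) where

  open Words C public

  ε : Fin r → ℤ
  ε l = + productExcept d l

  D : ℤ
  D = + product d

  d*ε≡D : ∀ l → + d l * ε l ≡ D
  d*ε≡D l = trans (sym (ℤP.pos-* (d l) (productExcept d l))) (cong +_ (*-productExcept d l))

  D-positive : 0ℤ < D
  D-positive = +<+ (product-positive d d-pos)

  ε-positive : ∀ l → 0ℤ < ε l
  ε-positive l = ℤP.*-cancelˡ-<-nonNeg (+ d l) (subst (_< + d l * ε l) (sym (ℤP.*-zeroʳ (+ d l))) (subst (0ℤ <_) (sym (d*ε≡D l)) D-positive))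

  ε≢0 : ∀ l → ε l ≢ 0ℤ
  ε≢0 l ε≡0 = ℤP.<-irrefl (sym ε≡0) (ε-positive l)

  Gram : Matrix r
  Gram k l = a k l * ε l

  Gram-symmetric : Symmetric Gram
  Gram-symmetric k l = ℤP.*-cancelˡ-≡ D (Gram k l) (Gram l k) ⦃ ℤ.>-nonZero D-positive ⦄ (begin
    D * (a k l * ε l)                 ≡⟨ cong (_* (a k l * ε l)) (sym (d*ε≡D k)) ⟩
    (+ d k * ε k) * (a k l * ε l)     ≡⟨ solve 4 (λ D E A F → (D :* E) :* (A :* F) := (D :* A) :* (E :* F)) refl (+ d k) (ε k) (a k l) (ε l) ⟩
    (+ d k * a k l) * (ε k * ε l)     ≡⟨ cong (_* (ε k * ε l)) (d-sym k l) ⟩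
    (+ d l * a l k) * (ε k * ε l)     ≡⟨ solve 4 (λ D A E F → (D :* A) :* (E :* F) := (D :* F) :* (A :* E)) refl (+ d l) (a l k) (ε k) (ε l) ⟩
    (+ d l * ε l) * (a l k * ε k)     ≡⟨ cong (_* (a l k * ε k)) (d*ε≡D l) ⟩
    D * (a l k * ε k) ∎)
    where open ≡-Reasoning

  ⟪_,_⟫ : Coroot r → Coroot r → ℤ
  ⟪ x , y ⟫ = ∑[ k < r ] (x k * (Gram *ᵥ y) k)

  ⟪⟫-congˡ : ∀ {x x′} y → x ≐ x′ → ⟪ x , y ⟫ ≡ ⟪ x′ , y ⟫
  ⟪⟫-congˡ y x≐x′ = sum-cong-≗ (λ k → cong (_* (Gram *ᵥ y) k) (x≐x′ k))

  ⟪⟫-congʳ : ∀ x {y y′} → y ≐ y′ → ⟪ x , y ⟫ ≡ ⟪ x , y′ ⟫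
  ⟪⟫-congʳ x y≐y′ = sum-cong-≗ (λ k → cong (x k *_) (sum-cong-≗ (λ l → cong (Gram k l *_) (y≐y′ l))))

  ⟪⟫-α : ∀ x i → ⟪ x , α i ⟫ ≡ pairRoot x i * ε i
  ⟪⟫-α x i = begin
    ∑[ k < r ] (x k * ∑[ l < r ] (Gram k l * α i l)) ≡⟨ sum-cong-≗ (λ k → cong (x k *_)
                                                         (trans (sum-cong-≗ (λ l → ℤP.*-comm (Gram k l) (α i l))) (sum-simpleCoroot i (Gram k)))) ⟩
    ∑[ k < r ] (x k * (a k i * ε i))                ≡⟨ sum-cong-≗ (λ k → sym (ℤP.*-assoc (x k) (a k i) (ε i))) ⟩
    ∑[ k < r ] (x k * a k i * ε i)                  ≡⟨ sum-*ʳ (ε i) (λ k → x k * a k i) ⟩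
    ∑[ k < r ] (x k * a k i) * ε i                  ≡⟨ cong (_* ε i) (sym (pairRoot-sum x i)) ⟩
    pairRoot x i * ε i ∎
    where open ≡-Reasoning

  ⟪⟫-sym : ∀ x y → ⟪ x , y ⟫ ≡ ⟪ y , x ⟫
  ⟪⟫-sym x y = begin
    ⟪ x , y ⟫                                           ≡⟨ sum-cong-≗ (λ k → sym (sum-*ˡ (x k) (λ l → Gram k l * y l))) ⟩
    ∑[ k < r ] ∑[ l < r ] (x k * (Gram k l * y l))     ≡⟨ ∑-comm (λ k l → x k * (Gram k l * y l)) ⟩
    ∑[ l < r ] ∑[ k < r ] (x k * (Gram k l * y l))     ≡⟨ sum-cong-≗ (λ l → sum-cong-≗ (λ k →
                                                            trans (cong (λ z → x k * (z * y l)) (Gram-symmetric k l))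
                                                                  (solve 3 (λ X B Y → X :* (B :* Y) := Y :* (B :* X)) refl (x k) (Gram l k) (y l)))) ⟩
    ∑[ l < r ] ∑[ k < r ] (y l * (Gram l k * x k))     ≡⟨ sum-cong-≗ (λ l → sum-*ˡ (y l) (λ k → Gram l k * x k)) ⟩
    ⟪ y , x ⟫ ∎
    where open ≡-Reasoning

  ⟪⟫-⊕ʳ : ∀ x y z → ⟪ x , y ⊕ z ⟫ ≡ ⟪ x , y ⟫ + ⟪ x , z ⟫
  ⟪⟫-⊕ʳ x y z =
    trans (sum-cong-≗ (λ k → trans (cong (x k *_) (trans (sum-cong-≗ (λ l → ℤP.*-distribˡ-+ (Gram k l) (y l) (z l)))
                                                           (∑-distrib-+ (λ l → Gram k l * y l) (λ l → Gram k l * z l))))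
                                   (ℤP.*-distribˡ-+ (x k) _ _)))
          (∑-distrib-+ (λ k → x k * (Gram *ᵥ y) k) (λ k → x k * (Gram *ᵥ z) k))

  ⟪⟫-·ʳ : ∀ x c y → ⟪ x , c · y ⟫ ≡ c * ⟪ x , y ⟫
  ⟪⟫-·ʳ x c y =
    trans (sum-cong-≗ (λ k → trans (cong (x k *_) (*ᵥ-scale Gram c y k))
                                   (solve 3 (λ X C S → X :* (C :* S) := C :* (X :* S)) refl (x k) c ((Gram *ᵥ y) k))))
          (sum-*ˡ c (λ k → x k * (Gram *ᵥ y) k))

  ⟪⟫-⊕ˡ : ∀ x y z → ⟪ x ⊕ y , z ⟫ ≡ ⟪ x , z ⟫ + ⟪ y , z ⟫
  ⟪⟫-⊕ˡ x y z = trans (⟪⟫-sym (x ⊕ y) z) (trans (⟪⟫-⊕ʳ z x y) (cong₂ _+_ (⟪⟫-sym z x) (⟪⟫-sym z y)))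

  ⟪⟫-·ˡ : ∀ c x y → ⟪ c · x , y ⟫ ≡ c * ⟪ x , y ⟫
  ⟪⟫-·ˡ c x y = trans (⟪⟫-sym (c · x) y) (trans (⟪⟫-·ʳ y c x) (cong (c *_) (⟪⟫-sym y x)))

  ⟪α,α⟫ : ∀ i → ⟪ α i , α i ⟫ ≡ + 2 * ε i
  ⟪α,α⟫ i = trans (⟪⟫-α (α i) i) (cong (_* ε i) (trans (pairRoot-α i i) (a-diag i)))

  ⟪⟫-refl-s : ∀ i x y → ⟪ refl-s i x , refl-s i y ⟫ ≡ ⟪ x , y ⟫
  ⟪⟫-refl-s i x y = begin
    ⟪ refl-s i x , refl-s i y ⟫                                    ≡⟨ trans (⟪⟫-congˡ (refl-s i y) (refl-s-⊕· i x)) (⟪⟫-congʳ (x ⊕ (P · α i)) (refl-s-⊕· i y)) ⟩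
    ⟪ x ⊕ (P · α i) , y ⊕ (Q · α i) ⟫                              ≡⟨ ⟪⟫-⊕ˡ x (P · α i) _ ⟩
    ⟪ x , y ⊕ (Q · α i) ⟫ + ⟪ P · α i , y ⊕ (Q · α i) ⟫            ≡⟨ cong₂ _+_ (⟪⟫-⊕ʳ x y _) (trans (⟪⟫-·ˡ P (α i) _) (cong (P *_) (⟪⟫-⊕ʳ (α i) y _))) ⟩
    (⟪ x , y ⟫ + ⟪ x , Q · α i ⟫) + P * (⟪ α i , y ⟫ + ⟪ α i , Q · α i ⟫)
        ≡⟨ cong₂ (λ u v → (⟪ x , y ⟫ + u) + P * (⟪ α i , y ⟫ + v)) (⟪⟫-·ʳ x Q (α i)) (⟪⟫-·ʳ (α i) Q (α i)) ⟩
    (⟪ x , y ⟫ + Q * ⟪ x , α i ⟫) + P * (⟪ α i , y ⟫ + Q * ⟪ α i , α i ⟫)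
        ≡⟨ cong₂ (λ u v → (⟪ x , y ⟫ + Q * u) + P * (v + Q * ⟪ α i , α i ⟫)) (⟪⟫-α x i) (trans (⟪⟫-sym (α i) y) (⟪⟫-α y i)) ⟩
    (⟪ x , y ⟫ + Q * (p * ε i)) + P * (q * ε i + Q * ⟪ α i , α i ⟫)
        ≡⟨ cong (λ u → (⟪ x , y ⟫ + Q * (p * ε i)) + P * (q * ε i + Q * u)) (⟪α,α⟫ i) ⟩
    (⟪ x , y ⟫ + Q * (p * ε i)) + P * (q * ε i + Q * (+ 2 * ε i))
        ≡⟨ solve 4 (λ B p q E → (B :+ (:- q) :* (p :* E)) :+ (:- p) :* (q :* E :+ (:- q) :* (con (+ 2) :* E)) := B) refl ⟪ x , y ⟫ p q (ε i) ⟩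
    ⟪ x , y ⟫ ∎
    where
      open ≡-Reasoning
      p = pairRoot x i
      q = pairRoot y i
      P = - p
      Q = - q

  ⟪⟫-act : ∀ w x y → ⟪ act w x , act w y ⟫ ≡ ⟪ x , y ⟫
  ⟪⟫-act []      x y = refl
  ⟪⟫-act (i ∷ w) x y = trans (⟪⟫-refl-s i (act w x) (act w y)) (⟪⟫-act w x y)

  symmetrised : Matrix r
  symmetrised i j = + d i * a i j

  symmetrised-positiveDefinite : PositiveDefinite symmetrised
  symmetrised-positiveDefinite x k xₖ≢0 = subst (0ℤ <_) frozen≡quadratic (posdef x (k , xₖ≢0))
    where
      frozen≡quadratic : sumFin (λ i → sumFin (λ j → x i * symmetrised i j * x j)) ≡ quadratic symmetrised x
      frozen≡quadratic =
        trans (sumFin≡sum (λ i → sumFin (λ j → x i * symmetrised i j * x j)))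
              (sum-cong-≗ (λ i → trans (sumFin≡sum (λ j → x i * symmetrised i j * x j))
                 (trans (sum-cong-≗ (λ j → ℤP.*-assoc (x i) (symmetrised i j) (x j))) (sum-*ˡ (x i) (λ j → symmetrised i j * x j)))))

  quadratic-symmetrised-ε : ∀ x → quadratic symmetrised (λ i → ε i * x i) ≡ D * ⟪ x , x ⟫
  quadratic-symmetrised-ε x = begin
    ∑[ i < r ] (ε i * x i * ∑[ j < r ] (symmetrised i j * (ε j * x j)))
        ≡⟨ sum-cong-≗ (λ i → trans (cong (ε i * x i *_) (sum-cong-≗ (λ j →
             solve 4 (λ Di A Ej Xj → Di :* A :* (Ej :* Xj) := Di :* (A :* Ej :* Xj)) refl (+ d i) (a i j) (ε j) (x j))))
           (trans (cong (ε i * x i *_) (sum-*ˡ (+ d i) (λ j → Gram i j * x j)))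
                  (solve 4 (λ E X Dd S → E :* X :* (Dd :* S) := Dd :* E :* (X :* S)) refl (ε i) (x i) (+ d i) ((Gram *ᵥ x) i)))) ⟩
    ∑[ i < r ] (+ d i * ε i * (x i * (Gram *ᵥ x) i))   ≡⟨ sum-cong-≗ (λ i → cong (_* (x i * (Gram *ᵥ x) i)) (d*ε≡D i)) ⟩
    ∑[ i < r ] (D * (x i * (Gram *ᵥ x) i))             ≡⟨ sum-*ˡ D (λ i → x i * (Gram *ᵥ x) i) ⟩
    D * ⟪ x , x ⟫ ∎
    where open ≡-Reasoning

  Gram-positiveDefinite : PositiveDefinite Gram
  Gram-positiveDefinite x k xₖ≢0 =
    0<i⇒0<i*j⇒0<j ⟪ x , x ⟫ D-positive
      (subst (0ℤ <_) (quadratic-symmetrised-ε x) (symmetrised-positiveDefinite (λ i → ε i * x i) k (i*j≢0 (ε≢0 k) xₖ≢0)))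

  ⟪x,x⟫-nonNeg : ∀ x → 0ℤ ≤ ⟪ x , x ⟫
  ⟪x,x⟫-nonNeg x with FinP.all? (λ k → x k ℤP.≟ 0ℤ)
  ... | yes x≐0 = ℤP.≤-reflexive (sym (trans (⟪⟫-congˡ x x≐0) (trans (sum-cong-≗ (λ k → ℤP.*-zeroˡ ((Gram *ᵥ x) k))) (sum-replicate-zero r))))
  ... | no x≢0 with ∃-≢0 x x≢0
  ...   | k , xₖ≢0 = ℤP.<⇒≤ (Gram-positiveDefinite x k xₖ≢0)

  -- Computed through the invariant form: comparing ⟪ α i , α i ⟫ with ⟪ w α i , w α i ⟫ gives ε i = c² ε j.
  pairRoot-act : ∀ w i j c x → c ≢ 0ℤ → root w i ≐ (c · α j) → pairRoot (act w x) j ≡ c * pairRoot x i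
  pairRoot-act w i j c x c≢0 wαᵢ≐cαⱼ =
    ℤP.*-cancelˡ-≡ (c * ε j) q (c * p) ⦃ ℤ.≢-nonZero (i*j≢0 c≢0 (ε≢0 j)) ⦄ (begin
      c * ε j * q                      ≡⟨ solve 3 (λ c E q → c :* E :* q := c :* (q :* E)) refl c (ε j) q ⟩
      c * (q * ε j)                    ≡⟨ cong (c *_) (sym (⟪⟫-α (act w x) j)) ⟩
      c * ⟪ act w x , α j ⟫            ≡⟨ sym (⟪⟫-·ʳ (act w x) c (α j)) ⟩
      ⟪ act w x , c · α j ⟫            ≡⟨ ⟪⟫-congʳ (act w x) (≐-sym wαᵢ≐cαⱼ) ⟩
      ⟪ act w x , act w (α i) ⟫        ≡⟨ ⟪⟫-act w x (α i) ⟩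
      ⟪ x , α i ⟫                      ≡⟨ ⟪⟫-α x i ⟩
      p * ε i                          ≡⟨ cong (p *_) εᵢ≡c²εⱼ ⟩
      p * (c * c * ε j)                ≡⟨ solve 3 (λ p c E → p :* (c :* c :* E) := c :* E :* (c :* p)) refl p c (ε j) ⟩
      c * ε j * (c * p) ∎)
    where
      open ≡-Reasoning
      p = pairRoot x i
      q = pairRoot (act w x) j
      εᵢ≡c²εⱼ : ε i ≡ c * c * ε j
      εᵢ≡c²εⱼ = ℤP.*-cancelˡ-≡ (+ 2) (ε i) (c * c * ε j) (begin
        + 2 * ε i                      ≡⟨ sym (⟪α,α⟫ i) ⟩
        ⟪ α i , α i ⟫                  ≡⟨ sym (⟪⟫-act w (α i) (α i)) ⟩
        ⟪ root w i , root w i ⟫        ≡⟨ trans (⟪⟫-congˡ (root w i) wαᵢ≐cαⱼ) (⟪⟫-congʳ (c · α j) wαᵢ≐cαⱼ) ⟩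
        ⟪ c · α j , c · α j ⟫          ≡⟨ trans (⟪⟫-·ˡ c (α j) _) (cong (c *_) (⟪⟫-·ʳ (α j) c (α j))) ⟩
        c * (c * ⟪ α j , α j ⟫)        ≡⟨ cong (λ z → c * (c * z)) (⟪α,α⟫ j) ⟩
        c * (c * (+ 2 * ε j))          ≡⟨ solve 2 (λ c E → c :* (c :* (con (+ 2) :* E)) := con (+ 2) :* (c :* c :* E)) refl c (ε j) ⟩
        + 2 * (c * c * ε j) ∎)

  act-refl-s : ∀ w i j c → c ≢ 0ℤ → root w i ≐ (c · α j) → ∀ x → act w (refl-s i x) ≐ refl-s j (act w x)
  act-refl-s w i j c c≢0 wαᵢ≐cαⱼ x k = begin
    act w (refl-s i x) k                      ≡⟨ act-cong w (refl-s-⊕· i x) k ⟩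
    act w (x ⊕ ((- p) · α i)) k               ≡⟨ act-⊕ w x ((- p) · α i) k ⟩
    act w x k + act w ((- p) · α i) k         ≡⟨ cong (_+_ (act w x k)) (trans (act-· w (- p) (α i) k) (cong ((- p) *_) (wαᵢ≐cαⱼ k))) ⟩
    act w x k + (- p) * (c * α j k)           ≡⟨ solve 4 (λ X p c E → X :+ (:- p) :* (c :* E) := X :- (c :* p) :* E) refl (act w x k) p c (α j k) ⟩
    act w x k - (c * p) * α j k               ≡⟨ cong (λ z → act w x k - z * α j k) (sym (pairRoot-act w i j c x c≢0 wαᵢ≐cαⱼ)) ⟩
    act w x k - pairRoot (act w x) j * α j k  ≡⟨ sym (refl-s-apply j (act w x) k) ⟩
    refl-s j (act w x) k ∎
    where
      open ≡-Reasoning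
      p = pairRoot x i

-- The dihedral group generated by s and t acting on x + p α_s + q α_t, in the coordinates (p , q);
-- here A = a s t, B = a t s and (P , Q) = (⟨x , α_s⟩ , ⟨x , α_t⟩).
module Dihedral where

  data RankTwoType : ℤ → ℤ → Set where
    A₁×A₁ : RankTwoType +0 +0
    A₂    : RankTwoType -[1+ 0 ] -[1+ 0 ]
    B₂    : RankTwoType -[1+ 1 ] -[1+ 0 ]
    B₂ᵀ   : RankTwoType -[1+ 0 ] -[1+ 1 ]
    G₂    : RankTwoType -[1+ 2 ] -[1+ 0 ]
    G₂ᵀ   : RankTwoType -[1+ 0 ] -[1+ 2 ]

  rankTwoType : ∀ A B → A ≤ 0ℤ → B ≤ 0ℤ → (A ≡ 0ℤ → B ≡ 0ℤ) → (B ≡ 0ℤ → A ≡ 0ℤ) → A * B < + 4 → RankTwoType A B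
  rankTwoType +0        +0        _ _ _ _ _ = A₁×A₁
  rankTwoType +0        -[1+ m ] _ _ A≡0⇒B≡0 _ _ with A≡0⇒B≡0 refl
  ... | ()
  rankTwoType -[1+ n ] +0        _ _ _ B≡0⇒A≡0 _ with B≡0⇒A≡0 refl
  ... | ()
  rankTwoType +[1+ n ] B (+≤+ ()) _ _ _ _
  rankTwoType A +[1+ n ] _ (+≤+ ()) _ _ _
  rankTwoType -[1+ n ] -[1+ m ] _ _ _ _ (+<+ nm<4) = negative n m nm<4
    where
      negative : ∀ n m → suc n ℕ.* suc m ℕ.< 4 → RankTwoType -[1+ n ] -[1+ m ]
      negative 0 0 _ = A₂
      negative 1 0 _ = B₂
      negative 0 1 _ = B₂ᵀ
      negative 2 0 _ = G₂
      negative 0 2 _ = G₂ᵀ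
      negative (suc (suc (suc n))) zero (s≤s (s≤s (s≤s (s≤s ()))))
      negative zero (suc (suc (suc m))) (s≤s (s≤s (s≤s (s≤s ()))))
      negative (suc n) (suc m) nm<4 = ⊥-elim (ℕP.<-irrefl refl (ℕP.<-≤-trans nm<4 4≤nm))
        where
          4≤nm : 4 ℕ.≤ suc (suc n) ℕ.* suc (suc m)
          4≤nm = ℕP.*-mono-≤ {2} {suc (suc n)} {2} {suc (suc m)} (s≤s (s≤s z≤n)) (s≤s (s≤s z≤n))

  braidOrder≥2 : ∀ {A B} → RankTwoType A B → ∃[ m ] (braidOrder A B ≡ suc (suc m))
  braidOrder≥2 A₁×A₁ = 0 , refl
  braidOrder≥2 A₂    = 1 , refl
  braidOrder≥2 B₂    = 2 , refl
  braidOrder≥2 B₂ᵀ   = 2 , refl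
  braidOrder≥2 G₂    = 4 , refl
  braidOrder≥2 G₂ᵀ   = 4 , refl

  reflect₂ : (A B P Q : ℤ) → Bool → ℤ × ℤ → ℤ × ℤ
  reflect₂ A B P Q true  (p , q) = (- p - B * q - P , q)
  reflect₂ A B P Q false (p , q) = (p , - q - A * p - Q)

  act₂ : (A B P Q : ℤ) → List Bool → ℤ × ℤ → ℤ × ℤ
  act₂ A B P Q w c = foldr (reflect₂ A B P Q) c w

  alternating : Bool → ℕ → List Bool
  alternating b zero    = []
  alternating b (suc k) = b ∷ alternating (not b) k

  lastLetter : Bool → ℕ → Bool
  lastLetter b zero    = b
  lastLetter b (suc k) = lastLetter (not b) k

  alternating-snoc : ∀ b k → alternating b (suc k) ≡ alternating b k ++ [ lastLetter b k ]
  alternating-snoc b zero    = refl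
  alternating-snoc b (suc k) = cong (b ∷_) (alternating-snoc (not b) k)

  alternating-+ : ∀ b i j → ∃[ b′ ] (alternating b (i ℕ.+ j) ≡ alternating b i ++ alternating b′ j)
  alternating-+ b zero    j = b , refl
  alternating-+ b (suc i) j with alternating-+ (not b) i j
  ... | b′ , split = b′ , cong (b ∷_) split

  length-alternating : ∀ b k → length (alternating b k) ≡ k
  length-alternating b zero    = refl
  length-alternating b (suc k) = cong suc (length-alternating (not b) k)

  combine : ℤ → ℤ → ℤ × ℤ → ℤ × ℤ → ℤ × ℤ
  combine P Q (u₁ , u₂) (v₁ , v₂) = (P * u₁ + Q * v₁ , P * u₂ + Q * v₂)

  -- The translation part is linear in (P , Q), so the braid relation reduces to the two basis cases.
  act₂-combine : ∀ A B P Q w u v → act₂ A B P Q w (combine P Q u v) ≡ combine P Q (act₂ A B (+ 1) 0ℤ w u) (act₂ A B 0ℤ (+ 1) w v)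
  act₂-combine A B P Q []          u v = refl
  act₂-combine A B P Q (true ∷ w)  u v rewrite act₂-combine A B P Q w u v
    with act₂ A B (+ 1) 0ℤ w u | act₂ A B 0ℤ (+ 1) w v
  ... | (u₁ , u₂) | (v₁ , v₂) = cong (_, P * u₂ + Q * v₂)
    (solve 7 (λ P Q u1 u2 v1 v2 B → :- (P :* u1 :+ Q :* v1) :- B :* (P :* u2 :+ Q :* v2) :- P
                                     := P :* (:- u1 :- B :* u2 :- con (+ 1)) :+ Q :* (:- v1 :- B :* v2 :- con 0ℤ)) refl P Q u₁ u₂ v₁ v₂ B)
  act₂-combine A B P Q (false ∷ w) u v rewrite act₂-combine A B P Q w u v
    with act₂ A B (+ 1) 0ℤ w u | act₂ A B 0ℤ (+ 1) w v
  ... | (u₁ , u₂) | (v₁ , v₂) = cong (P * u₁ + Q * v₁ ,_)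
    (solve 7 (λ P Q u1 u2 v1 v2 A → :- (P :* u2 :+ Q :* v2) :- A :* (P :* u1 :+ Q :* v1) :- Q
                                     := P :* (:- u2 :- A :* u1 :- con 0ℤ) :+ Q :* (:- v2 :- A :* v1 :- con (+ 1))) refl P Q u₁ u₂ v₁ v₂ A)

  combine-0 : ∀ P Q → combine P Q (0ℤ , 0ℤ) (0ℤ , 0ℤ) ≡ (0ℤ , 0ℤ)
  combine-0 P Q = cong₂ _,_ P0+Q0≡0 P0+Q0≡0
    where P0+Q0≡0 = solve 2 (λ P Q → P :* con 0ℤ :+ Q :* con 0ℤ := con 0ℤ) refl P Q

  braid₂-basis : ∀ {A B} → RankTwoType A B → let m = braidOrder A B in
    act₂ A B (+ 1) 0ℤ (alternating true m) (0ℤ , 0ℤ) ≡ act₂ A B (+ 1) 0ℤ (alternating false m) (0ℤ , 0ℤ) ×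
    act₂ A B 0ℤ (+ 1) (alternating true m) (0ℤ , 0ℤ) ≡ act₂ A B 0ℤ (+ 1) (alternating false m) (0ℤ , 0ℤ)
  braid₂-basis A₁×A₁ = refl , refl
  braid₂-basis A₂    = refl , refl
  braid₂-basis B₂    = refl , refl
  braid₂-basis B₂ᵀ   = refl , refl
  braid₂-basis G₂    = refl , refl
  braid₂-basis G₂ᵀ   = refl , refl

  braid₂ : ∀ {A B} → RankTwoType A B → ∀ P Q → let m = braidOrder A B in
    act₂ A B P Q (alternating true m) (0ℤ , 0ℤ) ≡ act₂ A B P Q (alternating false m) (0ℤ , 0ℤ)
  braid₂ {A} {B} R P Q = begin
    act₂ A B P Q (alternating true m) 0₂                                            ≡⟨ cong (act₂ A B P Q (alternating true m)) (sym (combine-0 P Q)) ⟩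
    act₂ A B P Q (alternating true m) (combine P Q 0₂ 0₂)                           ≡⟨ act₂-combine A B P Q (alternating true m) 0₂ 0₂ ⟩
    combine P Q (act₂ A B (+ 1) 0ℤ (alternating true m) 0₂) (act₂ A B 0ℤ (+ 1) (alternating true m) 0₂)
                                                                                    ≡⟨ cong₂ (combine P Q) (proj₁ (braid₂-basis R)) (proj₂ (braid₂-basis R)) ⟩
    combine P Q (act₂ A B (+ 1) 0ℤ (alternating false m) 0₂) (act₂ A B 0ℤ (+ 1) (alternating false m) 0₂)
                                                                                    ≡⟨ sym (act₂-combine A B P Q (alternating false m) 0₂ 0₂) ⟩
    act₂ A B P Q (alternating false m) (combine P Q 0₂ 0₂)                          ≡⟨ cong (act₂ A B P Q (alternating false m)) (combine-0 P Q) ⟩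
    act₂ A B P Q (alternating false m) 0₂ ∎
    where
      open ≡-Reasoning
      m = braidOrder A B
      0₂ = (0ℤ , 0ℤ)

  Nonneg₂ : ℤ × ℤ → Set
  Nonneg₂ (p , q) = 0ℤ ≤ p × 0ℤ ≤ q

  Nonpos₂ : ℤ × ℤ → Set
  Nonpos₂ (p , q) = p ≤ 0ℤ × q ≤ 0ℤ

  Coherent₂ : ℤ × ℤ → Set
  Coherent₂ c = Nonneg₂ c ⊎ Nonpos₂ c

  nonneg₂? : ∀ c → Dec (Nonneg₂ c)
  nonneg₂? (p , q) = (0ℤ ℤ.≤? p) ×-dec (0ℤ ℤ.≤? q)

  coherent₂? : ∀ c → Dec (Coherent₂ c)
  coherent₂? (p , q) = nonneg₂? (p , q) ⊎-dec ((p ℤ.≤? 0ℤ) ×-dec (q ℤ.≤? 0ℤ))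

  -- the coordinates of w α_s for w = alternating b k (the base point is x = 0)
  rootCoords : ℤ → ℤ → Bool → ℕ → ℤ × ℤ
  rootCoords A B b k = act₂ A B 0ℤ 0ℤ (alternating b k) (+ 1 , 0ℤ)

  CoherentRoots : ℤ → ℤ → ℕ → Set
  CoherentRoots A B k = Coherent₂ (rootCoords A B true k) × Coherent₂ (rootCoords A B false k)

  coherentRoots? : ∀ A B k → Dec (CoherentRoots A B k)
  coherentRoots? A B k = coherent₂? (rootCoords A B true k) ×-dec coherent₂? (rootCoords A B false k)

  rootCoords-coherent : ∀ {A B} → RankTwoType A B → ∀ (k : Fin (suc (braidOrder A B))) → CoherentRoots A B (toℕ k)
  rootCoords-coherent {A} {B} A₁×A₁ = from-yes (FinP.all? {n = suc (braidOrder A B)} (coherentRoots? A B ∘ toℕ))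
  rootCoords-coherent {A} {B} A₂    = from-yes (FinP.all? {n = suc (braidOrder A B)} (coherentRoots? A B ∘ toℕ))
  rootCoords-coherent {A} {B} B₂    = from-yes (FinP.all? {n = suc (braidOrder A B)} (coherentRoots? A B ∘ toℕ))
  rootCoords-coherent {A} {B} B₂ᵀ   = from-yes (FinP.all? {n = suc (braidOrder A B)} (coherentRoots? A B ∘ toℕ))
  rootCoords-coherent {A} {B} G₂    = from-yes (FinP.all? {n = suc (braidOrder A B)} (coherentRoots? A B ∘ toℕ))
  rootCoords-coherent {A} {B} G₂ᵀ   = from-yes (FinP.all? {n = suc (braidOrder A B)} (coherentRoots? A B ∘ toℕ))

  -- T (lastLetter b k) says that alternating b (suc k) = w s for w = alternating b k; with suc k ≤ braidOrder A B
  -- this w s is reduced, and then w α_s must be positive.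
  PositiveRoots : ℤ → ℤ → ℕ → Set
  PositiveRoots A B k = (T (lastLetter true k) → Nonneg₂ (rootCoords A B true k)) ×
                        (T (lastLetter false k) → Nonneg₂ (rootCoords A B false k))

  positiveRoots? : ∀ A B k → Dec (PositiveRoots A B k)
  positiveRoots? A B k = (T? (lastLetter true k) →-dec nonneg₂? (rootCoords A B true k)) ×-dec
                         (T? (lastLetter false k) →-dec nonneg₂? (rootCoords A B false k))

  rootCoords-positive : ∀ {A B} → RankTwoType A B → ∀ (k : Fin (braidOrder A B)) → PositiveRoots A B (toℕ k)
  rootCoords-positive {A} {B} A₁×A₁ = from-yes (FinP.all? {n = braidOrder A B} (positiveRoots? A B ∘ toℕ))
  rootCoords-positive {A} {B} A₂    = from-yes (FinP.all? {n = braidOrder A B} (positiveRoots? A B ∘ toℕ))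
  rootCoords-positive {A} {B} B₂    = from-yes (FinP.all? {n = braidOrder A B} (positiveRoots? A B ∘ toℕ))
  rootCoords-positive {A} {B} B₂ᵀ   = from-yes (FinP.all? {n = braidOrder A B} (positiveRoots? A B ∘ toℕ))
  rootCoords-positive {A} {B} G₂    = from-yes (FinP.all? {n = braidOrder A B} (positiveRoots? A B ∘ toℕ))
  rootCoords-positive {A} {B} G₂ᵀ   = from-yes (FinP.all? {n = braidOrder A B} (positiveRoots? A B ∘ toℕ))

open Dihedral

module RankTwo {r : ℕ} (C : CartanMatrix r) where

  open InvariantForm C public

  span : Fin r → Fin r → ℤ × ℤ → Coroot r
  span s t (p , q) = (p · α s) ⊕ (q · α t)

  sum-span : ∀ s t p q (f : Vector ℤ r) → ∑[ k < r ] (span s t (p , q) k * f k) ≡ p * f s + q * f t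
  sum-span s t p q f = begin
    ∑[ k < r ] ((p * α s k + q * α t k) * f k)             ≡⟨ sum-cong-≗ (λ k → solve 5 (λ F P Es Q Et → (P :* Es :+ Q :* Et) :* F := P :* (Es :* F) :+ Q :* (Et :* F))
                                                                                   refl (f k) p (α s k) q (α t k)) ⟩
    ∑[ k < r ] (p * (α s k * f k) + q * (α t k * f k))     ≡⟨ ∑-distrib-+ (λ k → p * (α s k * f k)) (λ k → q * (α t k * f k)) ⟩
    ∑[ k < r ] (p * (α s k * f k)) + ∑[ k < r ] (q * (α t k * f k))
        ≡⟨ cong₂ _+_ (trans (sum-*ˡ p (λ k → α s k * f k)) (cong (p *_) (sum-simpleCoroot s f)))
                     (trans (sum-*ˡ q (λ k → α t k * f k)) (cong (q *_) (sum-simpleCoroot t f))) ⟩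
    p * f s + q * f t ∎
    where open ≡-Reasoning

  quadratic-span : ∀ (M : Matrix r) s t p q →
    quadratic M (span s t (p , q)) ≡ p * (p * M s s + q * M s t) + q * (p * M t s + q * M t t)
  quadratic-span M s t p q =
    trans (sum-cong-≗ (λ i → cong (span s t (p , q) i *_) (row i))) (sum-span s t p q (λ i → p * M i s + q * M i t))
    where
      row : ∀ i → (M *ᵥ span s t (p , q)) i ≡ p * M i s + q * M i t
      row i = trans (sum-cong-≗ (λ j → ℤP.*-comm (M i j) _)) (sum-span s t p q (M i))

  -- Positivity of the form on -a s t α_s + 2 α_t gives a s t * a t s < 4.
  rankTwoType-of : ∀ {s t} → s ≢ t → RankTwoType (a s t) (a t s)
  rankTwoType-of {s} {t} s≢t =
    rankTwoType A B (a-offdiag s t s≢t) (a-offdiag t s (s≢t ∘ sym)) (a-zero s t) (a-zero t s) AB<4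
    where
      A = a s t
      B = a t s
      x = span s t (- A , + 2)
      value : quadratic symmetrised x ≡ (+ 2 * + d t) * (+ 4 - A * B)
      value = trans (quadratic-span symmetrised s t (- A) (+ 2))
        (trans (cong₂ (λ u v → (- A) * ((- A) * (+ d s * u) + + 2 * (+ d s * A)) + + 2 * ((- A) * (+ d t * B) + + 2 * (+ d t * v)))
                      (a-diag s) (a-diag t))
               (solve 4 (λ A B Ds Dt → (:- A) :* ((:- A) :* (Ds :* con (+ 2)) :+ con (+ 2) :* (Ds :* A)) :+ con (+ 2) :* ((:- A) :* (Dt :* B) :+ con (+ 2) :* (Dt :* con (+ 2)))
                                        := (con (+ 2) :* Dt) :* (con (+ 4) :- A :* B)) refl A B (+ d s) (+ d t)))
      xₜ≡2 : x t ≡ + 2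
      xₜ≡2 = trans (cong₂ (λ u v → (- A) * u + + 2 * v) (α-off s t (s≢t ∘ sym)) (α-self t))
                   (solve 1 (λ A → (:- A) :* con 0ℤ :+ con (+ 2) :* con (+ 1) := con (+ 2)) refl A)
      0<2dₜ : 0ℤ < + 2 * + d t
      0<2dₜ = subst (0ℤ <_) (ℤP.pos-* 2 (d t)) (+<+ (ℕP.*-mono-≤ {1} {2} (s≤s z≤n) (d-pos t)))
      0<4-AB : 0ℤ < + 4 - A * B
      0<4-AB = 0<i⇒0<i*j⇒0<j (+ 4 - A * B) 0<2dₜ
                 (subst (0ℤ <_) value (symmetrised-positiveDefinite x t (λ xₜ≡0 → ℤP.<-irrefl (trans (sym xₜ≡0) xₜ≡2) (+<+ (s≤s z≤n)))))
      AB<4 : A * B < + 4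
      AB<4 = subst₂ _<_ (ℤP.+-identityʳ (A * B)) (solve 2 (λ A B → A :* B :+ (con (+ 4) :- A :* B) := con (+ 4)) refl A B)
                        (ℤP.+-monoʳ-< (A * B) 0<4-AB)

  module Parabolic (s t : Fin r) (s≢t : s ≢ t) where

    A = a s t
    B = a t s
    R = rankTwoType-of s≢t
    m = braidOrder A B

    letter : Bool → Fin r
    letter b = if b then s else t

    word : List Bool → Word r
    word = map letter

    length-word : ∀ w → length (word w) ≡ length w
    length-word = ListP.length-map letter

    pairRoot-span : ∀ p q j → pairRoot (span s t (p , q)) j ≡ p * a s j + q * a t j
    pairRoot-span p q j = trans (pairRoot-⊕ (p · α s) (q · α t) j)
      (cong₂ _+_ (trans (pairRoot-· p (α s) j) (cong (p *_) (pairRoot-α s j)))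
                 (trans (pairRoot-· q (α t) j) (cong (q *_) (pairRoot-α t j))))

    refl-s-span : ∀ b x c → refl-s (letter b) (x ⊕ span s t c) ≐ (x ⊕ span s t (reflect₂ A B (pairRoot x s) (pairRoot x t) b c))
    refl-s-span true x (p , q) k = trans (refl-s-apply s (x ⊕ span s t (p , q)) k)
      (trans (cong (λ z → (x k + (p * α s k + q * α t k)) - z * α s k)
               (trans (pairRoot-⊕ x (span s t (p , q)) s) (cong (_+_ (pairRoot x s)) (trans (pairRoot-span p q s) (cong (λ z → p * z + q * B) (a-diag s))))))
             (solve 7 (λ X P Es Q Et Ps B → (X :+ (P :* Es :+ Q :* Et)) :- (Ps :+ (P :* con (+ 2) :+ Q :* B)) :* Es
                                           := X :+ ((:- P :- B :* Q :- Ps) :* Es :+ Q :* Et)) refl (x k) p (α s k) q (α t k) (pairRoot x s) B))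
    refl-s-span false x (p , q) k = trans (refl-s-apply t (x ⊕ span s t (p , q)) k)
      (trans (cong (λ z → (x k + (p * α s k + q * α t k)) - z * α t k)
               (trans (pairRoot-⊕ x (span s t (p , q)) t) (cong (_+_ (pairRoot x t)) (trans (pairRoot-span p q t) (cong (λ z → p * A + q * z) (a-diag t))))))
             (solve 7 (λ X P Es Q Et Qt A → (X :+ (P :* Es :+ Q :* Et)) :- (Qt :+ (P :* A :+ Q :* con (+ 2))) :* Et
                                           := X :+ (P :* Es :+ (:- Q :- A :* P :- Qt) :* Et)) refl (x k) p (α s k) q (α t k) (pairRoot x t) A))

    act-word-span : ∀ w x c → act (word w) (x ⊕ span s t c) ≐ (x ⊕ span s t (act₂ A B (pairRoot x s) (pairRoot x t) w c))
    act-word-span []      x c = ≐-refl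
    act-word-span (b ∷ w) x c = ≐-trans (refl-s-cong (letter b) (act-word-span w x c)) (refl-s-span b x _)

    braid : word (alternating true m) ≈W word (alternating false m)
    braid y = begin
      act (word (alternating true m)) y                      ≈⟨ act-cong (word (alternating true m)) y≐y+0 ⟩
      act (word (alternating true m)) (y ⊕ span s t 0₂)      ≈⟨ act-word-span (alternating true m) y 0₂ ⟩
      y ⊕ span s t (act₂ A B P Q (alternating true m) 0₂)    ≡⟨ cong (λ c → y ⊕ span s t c) (braid₂ R P Q) ⟩
      y ⊕ span s t (act₂ A B P Q (alternating false m) 0₂)   ≈⟨ ≐-sym (act-word-span (alternating false m) y 0₂) ⟩
      act (word (alternating false m)) (y ⊕ span s t 0₂)     ≈⟨ act-cong (word (alternating false m)) (≐-sym y≐y+0) ⟩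
      act (word (alternating false m)) y ∎
      where
        open import Relation.Binary.Reasoning.Setoid ≐-setoid
        0₂ = (0ℤ , 0ℤ)
        P = pairRoot y s
        Q = pairRoot y t
        y≐y+0 : y ≐ (y ⊕ span s t 0₂)
        y≐y+0 k = solve 3 (λ Y Es Et → Y := Y :+ (con 0ℤ :* Es :+ con 0ℤ :* Et)) refl (y k) (α s k) (α t k)

    braid-from : ∀ b → word (alternating (not b) m) ≈W word (alternating b m)
    braid-from true  = ≈W-sym {word (alternating true m)} {word (alternating false m)} braid
    braid-from false = braid

    ¬Reduced-after-braid : ∀ b n → word (alternating (not b) (suc (suc n))) ≈W word (alternating b (suc (suc n))) →
                           ¬ Reduced (word (alternating b (suc (suc (suc n)))))
    ¬Reduced-after-braid b n braided red = ℕP.<-irrefl refl (ℕP.≤-trans shorter (red short cancelled))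
      where
        short = word (alternating (not b) (suc n))
        cancelled : word (alternating b (suc (suc (suc n)))) ≈W short
        cancelled x = ≐-trans (refl-s-cong (letter b) (braided x)) (refl-s-involutive (letter b) (act short x))
        shorter : suc (length short) ℕ.≤ length (word (alternating b (suc (suc (suc n)))))
        shorter rewrite length-word (alternating (not b) (suc n)) | length-word (alternating b (suc (suc (suc n))))
                      | length-alternating (not b) (suc n) | length-alternating b (suc (suc (suc n))) = ℕP.n≤1+n _

    ¬Reduced-alternating : ∀ b → ¬ Reduced (word (alternating b (suc m)))
    ¬Reduced-alternating b = long (braidOrder≥2 R)
      where
        long : ∃[ n ] (m ≡ suc (suc n)) → ¬ Reduced (word (alternating b (suc m)))
        long (n , m≡2+n) = subst (λ k → ¬ Reduced (word (alternating b (suc k)))) (sym m≡2+n)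
                             (¬Reduced-after-braid b n (subst (λ k → word (alternating (not b) k) ≈W word (alternating b k)) m≡2+n (braid-from b)))

    reduced-alternating : ∀ b w → Reduced (word (b ∷ w)) → b ∷ w ≡ alternating b (suc (length w))
    reduced-alternating b     []          _   = refl
    reduced-alternating true  (true ∷ w)  red = ⊥-elim (¬Reduced-ss [] s (word w) red)
    reduced-alternating false (false ∷ w) red = ⊥-elim (¬Reduced-ss [] t (word w) red)
    reduced-alternating true  (false ∷ w) red = cong (true ∷_) (reduced-alternating false w (Reduced-++⁻ʳ [ s ] (t ∷ word w) red))
    reduced-alternating false (true ∷ w)  red = cong (false ∷_) (reduced-alternating true w (Reduced-++⁻ʳ [ t ] (s ∷ word w) red))

    reduced-word : ∀ w → Reduced (word w) → ∃[ b ] ∃[ k ] (w ≡ alternating b k × k ℕ.≤ m)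
    reduced-word []      _   = true , 0 , refl , z≤n
    reduced-word (b ∷ w) red with suc (length w) ℕ.≤? m
    ... | yes ≤m = b , suc (length w) , reduced-alternating b w red , ≤m
    ... | no  ≰m = ⊥-elim (¬Reduced-alternating b (Reduced-++⁻ˡ (word (alternating b (suc m))) (word (alternating b′ j)) red′))
      where
        j = length w ℕ.∸ m
        b′ = proj₁ (alternating-+ b (suc m) j)
        length≡ : suc m ℕ.+ j ≡ suc (length w)
        length≡ = cong suc (ℕP.m+[n∸m]≡n (ℕP.≤-pred (ℕP.≰⇒> ≰m)))
        red′ : Reduced (word (alternating b (suc m)) ++ word (alternating b′ j))
        red′ = subst Reduced (trans (cong word (trans (reduced-alternating b w red)
                                                      (trans (cong (alternating b) (sym length≡)) (proj₂ (alternating-+ b (suc m) j)))))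
                                    (ListP.map-++ letter (alternating b (suc m)) (alternating b′ j)))
                             red

    coords : List Bool → ℤ × ℤ
    coords w = act₂ A B 0ℤ 0ℤ w (+ 1 , 0ℤ)

    root-word : ∀ w → root (word w) s ≐ span s t (coords w)
    root-word w = begin
      act (word w) (α s)                                                  ≈⟨ act-cong (word w) αₛ≐0+span ⟩
      act (word w) (0ᶜ ⊕ span s t (+ 1 , 0ℤ))                              ≈⟨ act-word-span w 0ᶜ (+ 1 , 0ℤ) ⟩
      0ᶜ ⊕ span s t (act₂ A B (pairRoot 0ᶜ s) (pairRoot 0ᶜ t) w (+ 1 , 0ℤ)) ≡⟨ cong₂ (λ P Q → 0ᶜ ⊕ span s t (act₂ A B P Q w (+ 1 , 0ℤ))) (pairRoot-0ᶜ s) (pairRoot-0ᶜ t) ⟩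
      0ᶜ ⊕ span s t (coords w)                                             ≈⟨ (λ k → ℤP.+-identityˡ _) ⟩
      span s t (coords w) ∎
      where
        open import Relation.Binary.Reasoning.Setoid ≐-setoid
        αₛ≐0+span : α s ≐ (0ᶜ ⊕ span s t (+ 1 , 0ℤ))
        αₛ≐0+span k = solve 2 (λ Es Et → Es := con 0ℤ :+ (con (+ 1) :* Es :+ con 0ℤ :* Et)) refl (α s k) (α t k)

    coords-Coherent₂ : ∀ w → Reduced (word w) → Coherent₂ (coords w)
    coords-Coherent₂ w red with reduced-word w red
    ... | b , k , refl , k≤m = pick b
      where
        checked : CoherentRoots A B k
        checked = subst (CoherentRoots A B) (FinP.toℕ-fromℕ< (s≤s k≤m)) (rootCoords-coherent R (fromℕ< (s≤s k≤m)))
        pick : ∀ b → Coherent₂ (rootCoords A B b k)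
        pick true  = proj₁ checked
        pick false = proj₂ checked

    coords-Nonneg₂ : ∀ w → Reduced (word w ++ [ s ]) → Nonneg₂ (coords w)
    coords-Nonneg₂ w red with reduced-word (w ++ [ true ]) (subst Reduced (sym (ListP.map-++ letter w [ true ])) red)
    ... | b , zero  , w∷ʳtrue≡[] , _ = case ListP.++-conicalʳ w [ true ] w∷ʳtrue≡[] of λ ()
    ... | b , suc k , eq , k<m with ListP.∷ʳ-injective w (alternating b k) (trans eq (alternating-snoc b k))
    ...   | refl , true≡last = pick b true≡last
      where
        checked : PositiveRoots A B k
        checked = subst (PositiveRoots A B) (FinP.toℕ-fromℕ< k<m) (rootCoords-positive R (fromℕ< k<m))
        pick : ∀ b → true ≡ lastLetter b k → Nonneg₂ (rootCoords A B b k)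
        pick true  true≡last = proj₁ checked (subst T true≡last tt)
        pick false true≡last = proj₂ checked (subst T true≡last tt)

module RootSigns {r : ℕ} (C : CartanMatrix r) where

  open RankTwo C public

  CoherentUpTo : ℕ → Set
  CoherentUpTo n = ∀ z s → length z ℕ.≤ n → Coherent (root z s)

  multiple-of-α : ∀ {x} k → Nonneg x → Nonpos (refl-s k x) → x ≐ (x k · α k)
  multiple-of-α {x} k x≥0 sₖx≤0 j with j ≟ k
  ... | yes refl = sym (ℤP.*-identityʳ (x j))
  ... | no j≢k   = trans (ℤP.≤-antisym (subst (_≤ 0ℤ) (refl-s-off k x j j≢k) (sₖx≤0 j)) (x≥0 j)) (sym (ℤP.*-zeroʳ (x k)))

  -- A letter of p whose deletion has the effect of appending s (the deletion condition).
  record Deletion (p q : Word r) (s : Fin r) : Set where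
    field
      p₁ : Word r
      deleted : Fin r
      p₂ : Word r
      split : p ≡ p₁ ++ deleted ∷ p₂
      c : ℤ
      c≢0 : c ≢ 0ℤ
      root-multiple : act (p₂ ++ q) (α s) ≐ (c · α deleted)

  -- Reading p from the right, delete the letter k at which the root stops being nonnegative: by coherence it
  -- becomes nonpositive there, which forces it to be a multiple of α k.
  deletion : ∀ n p q s → CoherentUpTo n → length (p ++ q) ℕ.≤ n →
             Nonneg (act q (α s)) → ¬ Nonneg (act (p ++ q) (α s)) → Deletion p q s
  deletion n []      q s coh ≤n ≥0 ¬≥0 = ⊥-elim (¬≥0 ≥0)
  deletion n (k ∷ p) q s coh ≤n ≥0 ¬≥0 with nonneg? (act (p ++ q) (α s))
  ... | no ¬≥0′ = record { p₁ = k ∷ p₁ ; deleted = deleted ; p₂ = p₂ ; split = cong (k ∷_) split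
                         ; c = c ; c≢0 = c≢0 ; root-multiple = root-multiple }
    where open Deletion (deletion n p q s coh (ℕP.≤-trans (ℕP.n≤1+n _) ≤n) ≥0 ¬≥0′)
  ... | yes γ≥0 with coh (k ∷ p ++ q) s ≤n
  ...   | inj₁ sₖγ≥0 = ⊥-elim (¬≥0 sₖγ≥0)
  ...   | inj₂ sₖγ≤0 = record { p₁ = [] ; deleted = k ; p₂ = p ; split = refl ; c = γ k ; c≢0 = γₖ≢0 ; root-multiple = γ≐γₖαₖ }
    where
      γ = act (p ++ q) (α s)
      γ≐γₖαₖ = multiple-of-α k γ≥0 sₖγ≤0
      γₖ≢0 : γ k ≢ 0ℤ
      γₖ≢0 γₖ≡0 = root≢0 (p ++ q) s (λ j → trans (γ≐γₖαₖ j) (trans (cong (_* α k j) γₖ≡0) (ℤP.*-zeroˡ (α k j))))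

  deletion-≈W : ∀ {p q s} (del : Deletion p q s) → (Deletion.p₁ del ++ Deletion.p₂ del ++ q) ≈W ((p ++ q) ++ [ s ])
  deletion-≈W {p} {q} {s} del x = begin
    act (p₁ ++ p₂ ++ q) x                           ≡⟨ act-++ p₁ (p₂ ++ q) x ⟩
    act p₁ (act (p₂ ++ q) x)                        ≈⟨ act-cong p₁ (act-cong (p₂ ++ q) (≐-sym (refl-s-involutive s x))) ⟩
    act p₁ (act (p₂ ++ q) (refl-s s (refl-s s x)))  ≈⟨ act-cong p₁ (act-refl-s (p₂ ++ q) s deleted c c≢0 root-multiple (refl-s s x)) ⟩
    act p₁ (act (deleted ∷ p₂ ++ q) (refl-s s x))         ≡⟨ sym (act-++ p₁ (deleted ∷ p₂ ++ q) (refl-s s x)) ⟩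
    act (p₁ ++ deleted ∷ p₂ ++ q) (refl-s s x)            ≡⟨ cong (λ w → act w (refl-s s x)) (sym (ListP.++-assoc p₁ (deleted ∷ p₂) q)) ⟩
    act ((p₁ ++ deleted ∷ p₂) ++ q) (refl-s s x)          ≡⟨ cong (λ w → act (w ++ q) (refl-s s x)) (sym split) ⟩
    act (p ++ q) (refl-s s x)                       ≡⟨ sym (act-++ (p ++ q) [ s ] x) ⟩
    act ((p ++ q) ++ [ s ]) x ∎
    where
      open Deletion del
      open import Relation.Binary.Reasoning.Setoid ≐-setoid

  deletion-length : ∀ {p q s} (del : Deletion p q s) → length p ≡ suc (length (Deletion.p₁ del ++ Deletion.p₂ del))
  deletion-length del rewrite Deletion.split del | ListP.length-++ (Deletion.p₁ del) {Deletion.deleted del ∷ Deletion.p₂ del}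
                          | ListP.length-++ (Deletion.p₁ del) {Deletion.p₂ del} = ℕP.+-suc _ _

  Shortening : Word r → Fin r → Set
  Shortening v s = ∃[ v′ ] (v′ ≈W (v ++ [ s ]) × length v ≡ suc (length v′))

  descent-shortens : ∀ n v s → CoherentUpTo n → length v ℕ.≤ n → ¬ Nonneg (root v s) → Shortening v s
  descent-shortens n v s coh ≤n ¬≥0 = p₁ ++ p₂ , v′≈vs , deletion-length del
    where
      del = deletion n v [] s coh (subst (ℕ._≤ n) (sym (cong length (ListP.++-identityʳ v))) ≤n) (α-Nonneg s)
                   (subst (λ z → ¬ Nonneg (act z (α s))) (sym (ListP.++-identityʳ v)) ¬≥0)
      open Deletion del
      v′≈vs : (p₁ ++ p₂) ≈W (v ++ [ s ])
      v′≈vs x = subst₂ (λ z₁ z₂ → act z₁ x ≐ act (z₂ ++ [ s ]) x) (cong (p₁ ++_) (ListP.++-identityʳ p₂)) (ListP.++-identityʳ v) (deletion-≈W del x)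

  shortening-Reduced : ∀ {v s} → Reduced v → (sh : Shortening v s) → Reduced (proj₁ sh)
  shortening-Reduced {v} {s} v-red (v′ , v′≈vs , ∣v∣≡1+∣v′∣) u v′≈u =
    ℕP.≤-pred (subst₂ ℕ._≤_ ∣v∣≡1+∣v′∣ (length-snoc u s) (v-red (u ++ [ s ]) v≈us))
    where
      v≈us : v ≈W (u ++ [ s ])
      v≈us = ≈W-trans {v} {(v ++ [ s ]) ++ [ s ]} {u ++ [ s ]} (≈W-sym {(v ++ [ s ]) ++ [ s ]} {v} (cancel-ss-end v s))
               (++⁺ʳ-≈W [ s ] {v ++ [ s ]} {u} (≈W-trans {v ++ [ s ]} {v′} {u} (≈W-sym {v′} {v ++ [ s ]} v′≈vs) v′≈u))

  ascent-Reduced : ∀ n → CoherentUpTo n → ∀ z s → Reduced z → length z ℕ.≤ n → Nonneg (root z s) → Reduced (z ++ [ s ])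
  ascent-Reduced n coh z s z-red ≤n ≥0 y zs≈y with length (z ++ [ s ]) ℕ.≤? length y
  ... | yes ok = ok
  ... | no ≰  = ⊥-elim (ℕP.<-irrefl refl (ℕP.≤-trans (s≤s (z-red v′ z≈v′)) (subst (ℕ._≤ length z) ∣y∣≡1+∣v′∣ ∣y∣≤∣z∣)))
    where
      ∣y∣≤∣z∣ : length y ℕ.≤ length z
      ∣y∣≤∣z∣ = ℕP.≤-pred (subst (length y ℕ.<_) (length-snoc z s) (ℕP.≰⇒> ≰))
      ¬≥0 : ¬ Nonneg (root y s)
      ¬≥0 y≥0 = ¬Nonneg×Nonpos z s ≥0 (neg-Nonneg⁻¹ (Nonneg-resp (≐-trans (≐-sym (zs≈y (α s))) (root-snoc-self z s)) y≥0))
      shortening = descent-shortens n y s coh (ℕP.≤-trans ∣y∣≤∣z∣ ≤n) ¬≥0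
      v′ = proj₁ shortening
      ∣y∣≡1+∣v′∣ = proj₂ (proj₂ shortening)
      z≈v′ : z ≈W v′
      z≈v′ = ≈W-trans {z} {(z ++ [ s ]) ++ [ s ]} {v′} (≈W-sym {(z ++ [ s ]) ++ [ s ]} {z} (cancel-ss-end z s))
               (≈W-trans {(z ++ [ s ]) ++ [ s ]} {y ++ [ s ]} {v′} (++⁺ʳ-≈W [ s ] {z ++ [ s ]} {y} zs≈y)
                 (≈W-sym {v′} {y ++ [ s ]} (proj₁ (proj₂ shortening))))

  combination-Nonneg : ∀ {p q x y} → Nonneg₂ (p , q) → Nonneg x → Nonneg y → Nonneg ((p · x) ⊕ (q · y))
  combination-Nonneg (0≤p , 0≤q) x≥0 y≥0 k = ℤP.+-mono-≤ (0≤i*j 0≤p (x≥0 k)) (0≤i*j 0≤q (y≥0 k))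

  combination-Nonpos : ∀ {p q x y} → Nonpos₂ (p , q) → Nonneg x → Nonneg y → Nonpos ((p · x) ⊕ (q · y))
  combination-Nonpos (p≤0 , q≤0) x≥0 y≥0 k = ℤP.+-mono-≤ (i*j≤0 p≤0 (x≥0 k)) (i*j≤0 q≤0 (y≥0 k))

  ReducedForm : Word r → Set
  ReducedForm y = ∃[ z ] (Reduced z × z ≈W y × length z ℕ.≤ length y)

  record RootFacts (n : ℕ) : Set where
    field
      reduce   : ∀ y → length y ℕ.≤ n → ReducedForm y
      coherent : CoherentUpTo n
      descent  : ∀ y s → length y ℕ.≤ n → Reduced (y ++ [ s ]) → Nonneg (root y s)

  -- For y = y′ t reduced and s ≢ t, peel letters s, t off the right of y until y = v w with w a word in s, t
  -- and v without descents at s, t; then y α_s = v (w α_s) with w α_s a coherent combination of α_s, α_t.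
  module ParabolicFactorisation (n : ℕ) (facts : RootFacts n) (s t : Fin r) (s≢t : s ≢ t)
                                (y′ : Word r) (∣y′∣≤n : length y′ ℕ.≤ n) (y-red : Reduced (y′ ++ [ t ])) where

    open RootFacts facts
    open Parabolic s t s≢t

    y = y′ ++ [ t ]

    record Factorisation (ℓ : ℕ) : Set where
      field
        v : Word r
        w : List Bool
        v-length : length v ≡ ℓ
        factors : (v ++ word w) ≈W y
        total-length : ℓ ℕ.+ length w ≡ length y

    AscentFactorisation : Set
    AscentFactorisation = ∃[ ℓ ] Σ (Factorisation ℓ) λ F → Nonneg (root (Factorisation.v F) s) × Nonneg (root (Factorisation.v F) t)

    initial : Factorisation (length y′)
    initial = record { v = y′ ; w = [ false ] ; v-length = refl ; factors = ≈W-refl {y} ; total-length = sym (ListP.length-++ y′) }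

    shorten : ∀ {ℓ} b → suc ℓ ℕ.≤ n → (F : Factorisation (suc ℓ)) → ¬ Nonneg (root (Factorisation.v F) (letter b)) → Factorisation ℓ
    shorten {ℓ} b ≤n F ¬≥0 = shortened (descent-shortens n v (letter b) coherent (subst (ℕ._≤ n) (sym v-length) ≤n) ¬≥0)
      where
        open Factorisation F
        shortened : Shortening v (letter b) → Factorisation ℓ
        shortened (v′ , v′≈vb , ∣v∣≡1+∣v′∣) = record
          { v = v′
          ; w = b ∷ w
          ; v-length = ℕP.suc-injective (trans (sym ∣v∣≡1+∣v′∣) v-length)
          ; factors = ≈W-trans {v′ ++ word (b ∷ w)} {(v ++ [ letter b ]) ++ letter b ∷ word w} {y}
                        (++⁺ʳ-≈W (letter b ∷ word w) {v′} {v ++ [ letter b ]} v′≈vb)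
                        (≈W-trans {(v ++ [ letter b ]) ++ letter b ∷ word w} {v ++ word w} {y} (cancel-ss v (letter b) (word w)) factors)
          ; total-length = trans (ℕP.+-suc ℓ (length w)) total-length
          }

    ascending : ∀ ℓ → ℓ ℕ.≤ n → Factorisation ℓ → AscentFactorisation
    ascending zero    _  F = zero , F , no-descents (Factorisation.v F) (Factorisation.v-length F)
      where
        no-descents : ∀ v → length v ≡ 0 → Nonneg (root v s) × Nonneg (root v t)
        no-descents [] _ = α-Nonneg s , α-Nonneg t
    ascending (suc ℓ) ≤n F with nonneg? (root (Factorisation.v F) s) | nonneg? (root (Factorisation.v F) t)
    ... | yes ≥0ₛ | yes ≥0ₜ = suc ℓ , F , ≥0ₛ , ≥0ₜ
    ... | no ¬≥0ₛ | _       = ascending ℓ (ℕP.≤-trans (ℕP.n≤1+n ℓ) ≤n) (shorten true ≤n F ¬≥0ₛ)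
    ... | yes _   | no ¬≥0ₜ = ascending ℓ (ℕP.≤-trans (ℕP.n≤1+n ℓ) ≤n) (shorten false ≤n F ¬≥0ₜ)

    module _ {ℓ} (F : Factorisation ℓ) where
      open Factorisation F

      length-factors : length (v ++ word w) ≡ length y
      length-factors = trans (ListP.length-++ v) (trans (cong₂ ℕ._+_ v-length (length-word w)) total-length)

      factors-Reduced : Reduced (v ++ word w)
      factors-Reduced = Reduced-resp {y} {v ++ word w} y-red (≈W-sym {v ++ word w} {y} factors) (ℕP.≤-reflexive length-factors)

      root-y : root y s ≐ ((proj₁ (coords w) · root v s) ⊕ (proj₂ (coords w) · root v t))
      root-y = begin
        root y s                                 ≈⟨ ≐-sym (factors (α s)) ⟩
        act (v ++ word w) (α s)                  ≡⟨ act-++ v (word w) (α s) ⟩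
        act v (root (word w) s)                  ≈⟨ act-cong v (root-word w) ⟩
        act v (span s t (coords w))              ≈⟨ act-⊕ v _ _ ⟩
        act v (p · α s) ⊕ act v (q · α t)        ≈⟨ (λ k → cong₂ _+_ (act-· v p (α s) k) (act-· v q (α t) k)) ⟩
        (p · root v s) ⊕ (q · root v t) ∎
        where
          open import Relation.Binary.Reasoning.Setoid ≐-setoid
          p = proj₁ (coords w)
          q = proj₂ (coords w)

      ys-Reduced⇒ws-Reduced : Reduced (y ++ [ s ]) → Reduced (word w ++ [ s ])
      ys-Reduced⇒ws-Reduced ys-red = Reduced-++⁻ʳ v (word w ++ [ s ]) (subst Reduced (ListP.++-assoc v (word w) [ s ])
        (Reduced-resp {y ++ [ s ]} {(v ++ word w) ++ [ s ]} ys-red (++⁺ʳ-≈W [ s ] {y} {v ++ word w} (≈W-sym {v ++ word w} {y} factors))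
          (ℕP.≤-reflexive (trans (length-snoc (v ++ word w) s) (trans (cong suc length-factors) (sym (length-snoc y s)))))))

    result : Coherent (root y s) × (Reduced (y ++ [ s ]) → Nonneg (root y s))
    result with ascending (length y′) ∣y′∣≤n initial
    ... | ℓ , F , ≥0ₛ , ≥0ₜ = coherent-y , nonneg-y
      where
        open Factorisation F
        coherent-y : Coherent (root y s)
        coherent-y with coords-Coherent₂ w (Reduced-++⁻ʳ v (word w) (factors-Reduced F))
        ... | inj₁ pq≥0 = inj₁ (Nonneg-resp (≐-sym (root-y F)) (combination-Nonneg pq≥0 ≥0ₛ ≥0ₜ))
        ... | inj₂ pq≤0 = inj₂ (Nonpos-resp (≐-sym (root-y F)) (combination-Nonpos pq≤0 ≥0ₛ ≥0ₜ))
        nonneg-y : Reduced (y ++ [ s ]) → Nonneg (root y s)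
        nonneg-y ys-red = Nonneg-resp (≐-sym (root-y F)) (combination-Nonneg (coords-Nonneg₂ w (ys-Reduced⇒ws-Reduced F ys-red)) ≥0ₛ ≥0ₜ)

  rootFacts-zero : RootFacts 0
  rootFacts-zero = record { reduce = reduce ; coherent = coherent ; descent = descent }
    where
      reduce : ∀ y → length y ℕ.≤ 0 → ReducedForm y
      reduce [] _ = [] , Reduced-[] , ≈W-refl {[]} , z≤n
      coherent : CoherentUpTo 0
      coherent [] s _ = inj₁ (α-Nonneg s)
      descent : ∀ y s → length y ℕ.≤ 0 → Reduced (y ++ [ s ]) → Nonneg (root y s)
      descent [] s _ _ = α-Nonneg s

  module InductionStep (n : ℕ) (facts : RootFacts n) where

    open RootFacts facts
    module Factorise = ParabolicFactorisation n facts

    ∣init∣≤n : ∀ (y : Word r) i → length (y ++ [ i ]) ℕ.≤ suc n → length y ℕ.≤ n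
    ∣init∣≤n y i ≤1+n = ℕP.≤-pred (subst (ℕ._≤ suc n) (length-snoc y i) ≤1+n)

    reduce′ : ∀ y → length y ℕ.≤ suc n → ReducedForm y
    reduce′ y ≤1+n with reverseView y
    ... | [] = [] , Reduced-[] , ≈W-refl {[]} , z≤n
    ... | y′ ∶ _ ∶ʳ i with reduce y′ (∣init∣≤n y′ i ≤1+n)
    ...   | z , z-red , z≈y′ , ∣z∣≤∣y′∣ with nonneg? (root z i)
    ...     | yes ≥0 = z ++ [ i ] , ascent-Reduced n coherent z i z-red ∣z∣≤n ≥0 , ++⁺ʳ-≈W [ i ] {z} {y′} z≈y′ ,
                       subst₂ ℕ._≤_ (sym (length-snoc z i)) (sym (length-snoc y′ i)) (s≤s ∣z∣≤∣y′∣)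
      where ∣z∣≤n = ℕP.≤-trans ∣z∣≤∣y′∣ (∣init∣≤n y′ i ≤1+n)
    ...     | no ¬≥0 = v′ , shortening-Reduced {z} {i} z-red shortening , ≈W-trans {v′} {z ++ [ i ]} {y′ ++ [ i ]} v′≈zi (++⁺ʳ-≈W [ i ] {z} {y′} z≈y′) , ∣v′∣≤
      where
        shortening = descent-shortens n z i coherent (ℕP.≤-trans ∣z∣≤∣y′∣ (∣init∣≤n y′ i ≤1+n)) ¬≥0
        v′ = proj₁ shortening
        v′≈zi = proj₁ (proj₂ shortening)
        ∣v′∣≤ : length v′ ℕ.≤ length (y′ ++ [ i ])
        ∣v′∣≤ = subst (length v′ ℕ.≤_) (sym (length-snoc y′ i))
                  (ℕP.≤-trans (ℕP.n≤1+n _) (ℕP.≤-trans (subst (ℕ._≤ length y′) (proj₂ (proj₂ shortening)) ∣z∣≤∣y′∣) (ℕP.n≤1+n _)))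

    coherent-reduced : ∀ z s → length z ℕ.≤ suc n → Reduced z → Coherent (root z s)
    coherent-reduced z s ≤1+n z-red with reverseView z
    ... | [] = inj₁ (α-Nonneg s)
    ... | z′ ∶ _ ∶ʳ t with t ≟ s
    ...   | yes refl = Coherent-resp (≐-sym (root-snoc-self z′ t)) (neg-Coherent (coherent z′ t (∣init∣≤n z′ t ≤1+n)))
    ...   | no t≢s   = proj₁ (Factorise.result s t (t≢s ∘ sym) z′ (∣init∣≤n z′ t ≤1+n) z-red)

    coherent′ : CoherentUpTo (suc n)
    coherent′ y s ≤1+n with reduce′ y ≤1+n
    ... | z , z-red , z≈y , ∣z∣≤∣y∣ = Coherent-resp (z≈y (α s)) (coherent-reduced z s (ℕP.≤-trans ∣z∣≤∣y∣ ≤1+n) z-red)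

    descent′ : ∀ y s → length y ℕ.≤ suc n → Reduced (y ++ [ s ]) → Nonneg (root y s)
    descent′ y s ≤1+n ys-red with reverseView y
    ... | [] = α-Nonneg s
    ... | y′ ∶ _ ∶ʳ t with t ≟ s
    ...   | yes refl = ⊥-elim (¬Reduced-ss y′ t [] (subst Reduced (ListP.++-assoc y′ [ t ] [ t ]) ys-red))
    ...   | no t≢s   = proj₂ (Factorise.result s t (t≢s ∘ sym) y′ (∣init∣≤n y′ t ≤1+n) (Reduced-++⁻ˡ (y′ ++ [ t ]) [ s ] ys-red)) ys-red

  rootFacts-suc : ∀ n → RootFacts n → RootFacts (suc n)
  rootFacts-suc n facts = record { reduce = reduce′ ; coherent = coherent′ ; descent = descent′ }
    where open InductionStep n facts

  rootFacts : ∀ n → RootFacts n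
  rootFacts zero    = rootFacts-zero
  rootFacts (suc n) = rootFacts-suc n (rootFacts n)

  reducedForm : ∀ y → ReducedForm y
  reducedForm y = RootFacts.reduce (rootFacts (length y)) y ℕP.≤-refl

  root-Coherent : ∀ y s → Coherent (root y s)
  root-Coherent y s = RootFacts.coherent (rootFacts (length y)) y s ℕP.≤-refl

  coherentUpTo : ∀ n → CoherentUpTo n
  coherentUpTo n z s _ = root-Coherent z s

  Reduced-root-Nonneg : ∀ y s → Reduced (y ++ [ s ]) → Nonneg (root y s)
  Reduced-root-Nonneg y s = RootFacts.descent (rootFacts (length y)) y s ℕP.≤-refl

  Nonneg-root-Reduced : ∀ z s → Reduced z → Nonneg (root z s) → Reduced (z ++ [ s ])
  Nonneg-root-Reduced z s z-red ≥0 = ascent-Reduced (length z) (coherentUpTo _) z s z-red ℕP.≤-refl ≥0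

  delete : ∀ p q s → Nonneg (act q (α s)) → ¬ Nonneg (act (p ++ q) (α s)) → Deletion p q s
  delete p q s = deletion (length (p ++ q)) p q s (coherentUpTo _) ℕP.≤-refl

-- Reduced words have bounded length: along a reduced word the potential ⟪ w ρ , ρ ⟫ of a vector ρ
-- in the open dominant chamber drops by at least 1 at each letter, and it is bounded below by -⟪ ρ , ρ ⟫.
module LongestElement {r : ℕ} (C : CartanMatrix r) where

  open RootSigns C public

  -- Kept abstract: unfolding the Schur-complement recursion behind ρ makes type checking very slow.
  abstract
    ρ : Coroot r
    ρ = proj₁ (dominant Gram Gram-symmetric Gram-positiveDefinite)

    Gram*ρ-positive : ∀ k → 0ℤ < (Gram *ᵥ ρ) k
    Gram*ρ-positive = proj₂ (dominant Gram Gram-symmetric Gram-positiveDefinite)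

  pairRoot-ρ-positive : ∀ i → 0ℤ < pairRoot ρ i
  pairRoot-ρ-positive i = 0<i⇒0<i*j⇒0<j (pairRoot ρ i) (ε-positive i) (subst (0ℤ <_) Gram*ρ≡ (Gram*ρ-positive i))
    where
      Gram*ρ≡ : (Gram *ᵥ ρ) i ≡ ε i * pairRoot ρ i
      Gram*ρ≡ = trans (sym (sum-simpleCoroot i (Gram *ᵥ ρ)))
                      (trans (⟪⟫-sym (α i) ρ) (trans (⟪⟫-α ρ i) (ℤP.*-comm (pairRoot ρ i) (ε i))))

  ⟪γ,ρ⟫-positive : ∀ γ → Nonneg γ → ¬ (γ ≐ 0ᶜ) → 0ℤ < ⟪ γ , ρ ⟫
  ⟪γ,ρ⟫-positive γ γ≥0 γ≢0 with ∃-≢0 γ γ≢0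
  ... | k , γₖ≢0 = ℤP.<-≤-trans 0<γₖ*Gram*ρₖ
                     (term≤sum (λ j → γ j * (Gram *ᵥ ρ) j) (λ j → 0≤i*j (γ≥0 j) (ℤP.<⇒≤ (Gram*ρ-positive j))) k)
    where
      0<γₖ*Gram*ρₖ : 0ℤ < γ k * (Gram *ᵥ ρ) k
      0<γₖ*Gram*ρₖ = ℤP.*-monoʳ-<-pos ((Gram *ᵥ ρ) k) ⦃ ℤ.positive (Gram*ρ-positive k) ⦄
                       (ℤP.≤∧≢⇒< (γ≥0 k) (γₖ≢0 ∘ sym))

  potential : Word r → ℤ
  potential z = ⟪ act z ρ , ρ ⟫

  potential-snoc : ∀ z i → potential (z ++ [ i ]) ≡ potential z - pairRoot ρ i * ⟪ root z i , ρ ⟫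
  potential-snoc z i = begin
    ⟪ act (z ++ [ i ]) ρ , ρ ⟫                              ≡⟨ cong ⟪_, ρ ⟫ (act-++ z [ i ] ρ) ⟩
    ⟪ act z (refl-s i ρ) , ρ ⟫                              ≡⟨ ⟪⟫-congˡ ρ (≐-trans (act-cong z (refl-s-⊕· i ρ)) (act-⊕ z ρ _)) ⟩
    ⟪ act z ρ ⊕ act z ((- π) · α i) , ρ ⟫                   ≡⟨ ⟪⟫-⊕ˡ (act z ρ) _ ρ ⟩
    potential z + ⟪ act z ((- π) · α i) , ρ ⟫               ≡⟨ cong (_+_ (potential z)) (trans (⟪⟫-congˡ ρ (act-· z (- π) (α i))) (⟪⟫-·ˡ (- π) (root z i) ρ)) ⟩
    potential z + (- π) * ⟪ root z i , ρ ⟫                  ≡⟨ cong (_+_ (potential z)) (sym (ℤP.neg-distribˡ-* π ⟪ root z i , ρ ⟫)) ⟩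
    potential z - π * ⟪ root z i , ρ ⟫ ∎
    where
      open ≡-Reasoning
      π = pairRoot ρ i

  potential-decreasing : ∀ z i → Reduced (z ++ [ i ]) → potential (z ++ [ i ]) + + 1 ≤ potential z
  potential-decreasing z i zi-red =
    subst₂ _≤_ (sym shape) (ℤP.+-identityʳ (potential z)) (ℤP.+-monoʳ-≤ (potential z) (ℤP.neg-mono-≤ (ℤP.i≤j⇒0≤j-i 1≤drop)))
    where
      drop′ = pairRoot ρ i * ⟪ root z i , ρ ⟫
      1≤drop : + 1 ≤ drop′
      1≤drop = 0<i⇒1≤i (subst (_< drop′) (ℤP.*-zeroʳ (pairRoot ρ i))
                 (ℤP.*-monoˡ-<-pos (pairRoot ρ i) ⦃ ℤ.positive (pairRoot-ρ-positive i) ⦄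
                   (⟪γ,ρ⟫-positive (root z i) (Reduced-root-Nonneg z i zi-red) (root≢0 z i))))
      shape : potential (z ++ [ i ]) + + 1 ≡ potential z + - (drop′ - + 1)
      shape = trans (cong (_+ + 1) (potential-snoc z i))
                    (solve 2 (λ P D → P :- D :+ con (+ 1) := P :+ :- (D :- con (+ 1))) refl (potential z) drop′)

  -- ⟪ u + ρ , u + ρ ⟫ ≥ 0 with ⟪ u , u ⟫ = ⟪ ρ , ρ ⟫ for u = z ρ.
  potential-≥ : ∀ z → - ⟪ ρ , ρ ⟫ ≤ potential z
  potential-≥ z = subst₂ _≤_ (ℤP.+-identityʳ (- ⟪ ρ , ρ ⟫)) (solve 2 (λ B F → :- B :+ (B :+ F) := F) refl ⟪ ρ , ρ ⟫ (potential z))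
                    (ℤP.+-monoʳ-≤ (- ⟪ ρ , ρ ⟫) (half (subst (0ℤ ≤_) expand (⟪x,x⟫-nonNeg (u ⊕ ρ)))))
    where
      u = act z ρ
      half : ∀ {x} → 0ℤ ≤ + 2 * x → 0ℤ ≤ x
      half {+ n}      _ = +≤+ z≤n
      half { -[1+ n ]} ()
      expand : ⟪ u ⊕ ρ , u ⊕ ρ ⟫ ≡ + 2 * (⟪ ρ , ρ ⟫ + potential z)
      expand = trans (⟪⟫-⊕ˡ u ρ (u ⊕ ρ)) (trans (cong₂ _+_ (⟪⟫-⊕ʳ u u ρ) (⟪⟫-⊕ʳ ρ u ρ))
        (trans (cong₂ (λ p q → (p + potential z) + (q + ⟪ ρ , ρ ⟫)) (⟪⟫-act z ρ ρ) (⟪⟫-sym ρ u))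
               (solve 2 (λ B F → (B :+ F) :+ (F :+ B) := con (+ 2) :* (B :+ F)) refl ⟪ ρ , ρ ⟫ (potential z))))

  length+potential≤ : ∀ {z} → Reverse z → Reduced z → + length z + potential z ≤ ⟪ ρ , ρ ⟫
  length+potential≤ []              _     = ℤP.≤-reflexive (ℤP.+-identityˡ ⟪ ρ , ρ ⟫)
  length+potential≤ (z ∶ z-view ∶ʳ i) zi-red = begin
    + length (z ++ [ i ]) + potential (z ++ [ i ])  ≡⟨ cong (λ n → + n + potential (z ++ [ i ])) (length-snoc z i) ⟩
    + suc (length z) + potential (z ++ [ i ])       ≡⟨ solve 2 (λ L F → con (+ 1) :+ L :+ F := L :+ (F :+ con (+ 1))) refl (+ length z) (potential (z ++ [ i ])) ⟩
    + length z + (potential (z ++ [ i ]) + + 1)     ≤⟨ ℤP.+-monoʳ-≤ (+ length z) (potential-decreasing z i zi-red) ⟩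
    + length z + potential z                        ≤⟨ length+potential≤ z-view (Reduced-++⁻ˡ z [ i ] zi-red) ⟩
    ⟪ ρ , ρ ⟫ ∎
    where open ℤP.≤-Reasoning

  maxLength : ℕ
  maxLength = ∣ + 2 * ⟪ ρ , ρ ⟫ ∣

  Reduced-length≤ : ∀ z → Reduced z → length z ℕ.≤ maxLength
  Reduced-length≤ z z-red = ℤP.drop‿+≤+ (begin
    + length z                                      ≡⟨ solve 2 (λ L F → L := L :+ F :- F) refl (+ length z) (potential z) ⟩
    + length z + potential z - potential z          ≤⟨ ℤP.+-monoˡ-≤ (- potential z) (length+potential≤ (reverseView z) z-red) ⟩
    ⟪ ρ , ρ ⟫ - potential z                         ≤⟨ ℤP.+-monoʳ-≤ ⟪ ρ , ρ ⟫ (ℤP.neg-mono-≤ (potential-≥ z)) ⟩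
    ⟪ ρ , ρ ⟫ - - ⟪ ρ , ρ ⟫                         ≡⟨ solve 1 (λ B → B :- :- B := con (+ 2) :* B) refl ⟪ ρ , ρ ⟫ ⟩
    + 2 * ⟪ ρ , ρ ⟫                                 ≡⟨ sym (ℤP.0≤i⇒+∣i∣≡i (0≤i*j {+ 2} {⟪ ρ , ρ ⟫} (+≤+ z≤n) (⟪x,x⟫-nonNeg ρ))) ⟩
    + maxLength ∎)
    where open ℤP.≤-Reasoning

  AllDescents : Word r → Set
  AllDescents z = ∀ i → ¬ Nonneg (root z i)

  -- Append ascents while there are any; since reduced words have length ≤ maxLength, that much fuel suffices.
  extend : ∀ fuel z → Reduced z → maxLength ℕ.≤ length z ℕ.+ fuel → ∃[ v ] (Reduced (z ++ v) × AllDescents (z ++ v))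
  extend zero z z-red ≤z = [] , subst Reduced (sym (ListP.++-identityʳ z)) z-red , all-descents
    where
      all-descents : AllDescents (z ++ [])
      all-descents i ≥0 = ℕP.<-irrefl refl (ℕP.≤-trans (subst (ℕ._≤ maxLength) (length-snoc z i) (Reduced-length≤ (z ++ [ i ]) zi-red))
                                                       (subst (maxLength ℕ.≤_) (ℕP.+-identityʳ (length z)) ≤z))
        where zi-red = Nonneg-root-Reduced z i z-red (subst (λ w → Nonneg (root w i)) (ListP.++-identityʳ z) ≥0)
  extend (suc fuel) z z-red ≤z+fuel with FinP.any? (λ i → nonneg? (root z i))
  ... | no  no-ascent     = [] , subst Reduced (sym (ListP.++-identityʳ z)) z-red ,
                            (λ i ≥0 → no-ascent (i , subst (λ w → Nonneg (root w i)) (ListP.++-identityʳ z) ≥0))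
  ... | yes (i , ascent) with extend fuel (z ++ [ i ]) (Nonneg-root-Reduced z i z-red ascent)
                                (subst (maxLength ℕ.≤_) (trans (ℕP.+-suc (length z) fuel) (cong (ℕ._+ fuel) (sym (length-snoc z i)))) ≤z+fuel)
  ...   | v , ziv-red , ziv-descents = i ∷ v , subst (λ w → Reduced w × AllDescents w) (ListP.++-assoc z [ i ] v) (ziv-red , ziv-descents)

  -- Induction on y from the right: every letter i is a descent of z, so the deletion condition removes a letter of x.
  RightFactor : Word r → Word r → Set
  RightFactor y z = ∃[ x ] ((x ++ y) ≈W z × length x ℕ.+ length y ≡ length z)

  rightFactor : ∀ z → Reduced z → AllDescents z → ∀ {y} → Reverse y → Reduced y → RightFactor y z
  rightFactor z _ _ [] _ = z , subst (λ w → w ≈W z) (sym (ListP.++-identityʳ z)) (≈W-refl {z}) , ℕP.+-identityʳ (length z)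
  rightFactor z z-red z-descents (y ∶ y-view ∶ʳ i) yi-red with rightFactor z z-red z-descents y-view (Reduced-++⁻ˡ y [ i ] yi-red)
  ... | x , xy≈z , length-xy = p₁ ++ p₂ , x′yi≈z , length-x′yi
    where
      del = delete x y i (Reduced-root-Nonneg y i yi-red) (λ ≥0 → z-descents i (Nonneg-resp (xy≈z (α i)) ≥0))
      open Deletion del
      x′yi≈z : ((p₁ ++ p₂) ++ (y ++ [ i ])) ≈W z
      x′yi≈z u = begin
        act ((p₁ ++ p₂) ++ (y ++ [ i ])) u    ≡⟨ cong (λ w → act w u) (trans (ListP.++-assoc p₁ p₂ (y ++ [ i ])) (cong (p₁ ++_) (sym (ListP.++-assoc p₂ y [ i ])))) ⟩
        act (p₁ ++ (p₂ ++ y) ++ [ i ]) u      ≡⟨ trans (act-++ p₁ _ u) (cong (act p₁) (act-++ (p₂ ++ y) [ i ] u)) ⟩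
        act p₁ (act (p₂ ++ y) (refl-s i u))   ≡⟨ sym (act-++ p₁ (p₂ ++ y) (refl-s i u)) ⟩
        act (p₁ ++ p₂ ++ y) (refl-s i u)      ≈⟨ deletion-≈W del (refl-s i u) ⟩
        act ((x ++ y) ++ [ i ]) (refl-s i u)  ≡⟨ act-++ (x ++ y) [ i ] (refl-s i u) ⟩
        act (x ++ y) (refl-s i (refl-s i u))  ≈⟨ act-cong (x ++ y) (refl-s-involutive i u) ⟩
        act (x ++ y) u                        ≈⟨ xy≈z u ⟩
        act z u ∎
        where open import Relation.Binary.Reasoning.Setoid ≐-setoid
      length-x′yi : length (p₁ ++ p₂) ℕ.+ length (y ++ [ i ]) ≡ length z
      length-x′yi = trans (cong (length (p₁ ++ p₂) ℕ.+_) (length-snoc y i))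
                          (trans (ℕP.+-suc _ _) (trans (cong (ℕ._+ length y) (sym (deletion-length del))) length-xy))

  AllDescents⇒IsLongestWord : ∀ z → Reduced z → AllDescents z → IsLongestWord z
  AllDescents⇒IsLongestWord z z-red z-descents = z-red , λ y y-red → shorter (rightFactor z z-red z-descents (reverseView y) y-red)
    where
      shorter : ∀ {y} → RightFactor y z → length y ℕ.≤ length z
      shorter {y} (x , _ , length-xy) = subst (length y ℕ.≤_) length-xy (ℕP.m≤n+m (length y) (length x))

  IsLongestWord⇒AllDescents : ∀ z → IsLongestWord z → AllDescents z
  IsLongestWord⇒AllDescents z (z-red , z-longest) i ≥0 =
    ℕP.<-irrefl refl (subst (ℕ._≤ length z) (length-snoc z i) (z-longest (z ++ [ i ]) (Nonneg-root-Reduced z i z-red ≥0)))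

  extend-to-longest : ∀ u → Reduced u → ∃[ v ] IsLongestWord (u ++ v)
  extend-to-longest u u-red with extend maxLength u u-red (ℕP.m≤n+m maxLength (length u))
  ... | v , uv-red , uv-descents = v , AllDescents⇒IsLongestWord (u ++ v) uv-red uv-descents

  longest-unique : ∀ u₀ u₁ → IsLongestWord u₀ → IsLongestWord u₁ → u₀ ≈W u₁
  longest-unique u₀ u₁ u₀-longest@(u₀-red , _) (u₁-red , u₁-longest)
    with rightFactor u₀ u₀-red (IsLongestWord⇒AllDescents u₀ u₀-longest) (reverseView u₁) u₁-red
  ... | []    , u₁≈u₀ , _         = ≈W-sym {u₁} {u₀} u₁≈u₀
  ... | _ ∷ x , _     , length-xu₁ = ⊥-elim (ℕP.m+n≮n (length x) (length u₁) (subst (ℕ._≤ length u₁) (sym length-xu₁) (u₁-longest u₀ u₀-red)))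

module LusztigData {r : ℕ} (C : CartanMatrix r) (μ : Word r → Coroot r) (P : MV.IsMVPolytope C μ) where

  open LongestElement C
  open IsMVPolytope P

  height : Coroot r → ℤ
  height x = sum x

  lusztigAlong : ∀ base is → ∃[ ns ] LusztigAlong μ base is ns
  lusztigAlong base []       = [] , tt
  lusztigAlong base (i ∷ is) with edge base i | lusztigAlong (base ++ [ i ]) is
  ... | n , μ-edge | ns , along = n ∷ ns , μ-edge , along

  LusztigAlong-drop : ∀ base u v ns → LusztigAlong μ base (u ++ v) ns → LusztigAlong μ (base ++ u) v (drop (length u) ns)
  LusztigAlong-drop base []      v ns       along = subst (λ b → LusztigAlong μ b v ns) (sym (ListP.++-identityʳ base)) along
  LusztigAlong-drop base (i ∷ u) v (n ∷ ns) (_ , along) =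
    subst (λ b → LusztigAlong μ b v (drop (length u) ns)) (ListP.++-assoc base [ i ] u) (LusztigAlong-drop (base ++ [ i ]) u v ns along)

  LusztigAlong-zeros : ∀ base v ns → LusztigAlong μ base v ns → All (_≡ 0) ns → μ (base ++ v) ≐ μ base
  LusztigAlong-zeros base []      []       _              _           k = cong (λ b → μ b k) (ListP.++-identityʳ base)
  LusztigAlong-zeros base (i ∷ v) (n ∷ ns) (μ-edge , along) (refl ∷ zeros) k = begin
    μ (base ++ i ∷ v) k            ≡⟨ cong (λ b → μ b k) (sym (ListP.++-assoc base [ i ] v)) ⟩
    μ ((base ++ [ i ]) ++ v) k     ≡⟨ LusztigAlong-zeros (base ++ [ i ]) v ns along zeros k ⟩
    μ (base ++ [ i ]) k            ≡⟨ μ-edge k ⟩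
    μ base k + 0ℤ * root base i k  ≡⟨ cong (_+_ (μ base k)) (ℤP.*-zeroˡ (root base i k)) ⟩
    μ base k + 0ℤ                  ≡⟨ ℤP.+-identityʳ (μ base k) ⟩
    μ base k ∎
    where open ≡-Reasoning

  height-root : ∀ base i → Reduced (base ++ [ i ]) → + 1 ≤ height (root base i)
  height-root base i red with ∃-≢0 (root base i) (root≢0 base i)
  ... | k , γₖ≢0 = ℤP.≤-trans (0<i⇒1≤i (ℤP.≤∧≢⇒< (γ≥0 k) (γₖ≢0 ∘ sym))) (term≤sum (root base i) γ≥0 k)
    where γ≥0 = Reduced-root-Nonneg base i red

  height-edge : ∀ base i n → μ (base ++ [ i ]) ≐ (μ base ⊕ (n ⊙ root base i)) →
                height (μ (base ++ [ i ])) ≡ height (μ base) + + n * height (root base i)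
  height-edge base i n μ-edge =
    trans (sum-cong-≗ μ-edge) (trans (∑-distrib-+ (μ base) (λ k → + n * root base i k)) (cong (_+_ (height (μ base))) (sum-*ˡ (+ n) (root base i))))

  height-LusztigAlong : ∀ base v ns → LusztigAlong μ base v ns → Reduced (base ++ v) → height (μ base) + + sumℕ ns ≤ height (μ (base ++ v))
  height-LusztigAlong base []      []       _ _ = ℤP.≤-reflexive (trans (ℤP.+-identityʳ _) (cong (λ b → height (μ b)) (sym (ListP.++-identityʳ base))))
  height-LusztigAlong base (i ∷ v) (n ∷ ns) (μ-edge , along) red = begin
    height (μ base) + + (n ℕ.+ sumℕ ns)                 ≡⟨ cong (_+_ (height (μ base))) (ℤP.pos-+ n (sumℕ ns)) ⟩
    height (μ base) + (+ n + + sumℕ ns)                 ≡⟨ sym (ℤP.+-assoc (height (μ base)) (+ n) (+ sumℕ ns)) ⟩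
    height (μ base) + + n + + sumℕ ns                   ≤⟨ ℤP.+-monoˡ-≤ (+ sumℕ ns) (ℤP.+-monoʳ-≤ (height (μ base)) n≤n*height) ⟩
    height (μ base) + + n * height (root base i) + + sumℕ ns ≡⟨ cong (_+ + sumℕ ns) (sym (height-edge base i n μ-edge)) ⟩
    height (μ (base ++ [ i ])) + + sumℕ ns              ≤⟨ height-LusztigAlong (base ++ [ i ]) v ns along red′ ⟩
    height (μ ((base ++ [ i ]) ++ v))                   ≡⟨ cong (λ b → height (μ b)) (ListP.++-assoc base [ i ] v) ⟩
    height (μ (base ++ i ∷ v)) ∎
    where
      open ℤP.≤-Reasoning
      red′ : Reduced ((base ++ [ i ]) ++ v)
      red′ = subst Reduced (sym (ListP.++-assoc base [ i ] v)) red
      n≤n*height : + n ≤ + n * height (root base i)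
      n≤n*height = subst (_≤ + n * height (root base i)) (ℤP.*-identityʳ (+ n))
                     (ℤP.*-monoˡ-≤-nonNeg (+ n) (height-root base i (Reduced-++⁻ˡ (base ++ [ i ]) v red′)))

  LusztigAlong-vanishes : ∀ base v ns → LusztigAlong μ base v ns → Reduced (base ++ v) → μ (base ++ v) ≐ μ base → All (_≡ 0) ns
  LusztigAlong-vanishes base v ns along red μ≐μ = sumℕ≡0⇒zeros ns (ℕP.n≤0⇒n≡0 (ℤP.drop‿+≤+ sum≤0))
    where
      sumℕ≡0⇒zeros : ∀ (ns : List ℕ) → sumℕ ns ≡ 0 → All (_≡ 0) ns
      sumℕ≡0⇒zeros []       _   = []
      sumℕ≡0⇒zeros (n ∷ ns) sum≡0 = ℕP.m+n≡0⇒m≡0 n sum≡0 ∷ sumℕ≡0⇒zeros ns (ℕP.m+n≡0⇒n≡0 n sum≡0)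
      sum≤0 : + sumℕ ns ≤ 0ℤ
      sum≤0 = +-cancelˡ-≤ (height (μ base)) {+ sumℕ ns} {0ℤ}
                (subst (height (μ base) + + sumℕ ns ≤_) (trans (sum-cong-≗ μ≐μ) (sym (ℤP.+-identityʳ _))) (height-LusztigAlong base v ns along red))

module Criterion {r : ℕ} (C : CartanMatrix r) (μ : Word r → Coroot r) (P : MV.IsMVPolytope C μ) (w : Word r) where

  open LongestElement C
  open LusztigData C μ P
  open IsMVPolytope P

  AdaptedDatum : Set
  AdaptedDatum = ∃[ u ] ∃[ v ] ∃[ n ] (IsLongestWord (u ++ v) × IsReducedWordOf u w × LusztigDatum μ (u ++ v) n)

  adaptedDatum : AdaptedDatum
  adaptedDatum with reducedForm w
  ... | u , u-red , u≈w , _ with extend-to-longest u u-red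
  ...   | v , uv-longest = u , v , proj₁ (lusztigAlong [] (u ++ v)) , uv-longest , (u-red , u≈w) , proj₂ (lusztigAlong [] (u ++ v))

  SomeAdaptedDatumVanishes : Set
  SomeAdaptedDatumVanishes = ∃[ u ] ∃[ v ] ∃[ n ] (IsLongestWord (u ++ v) × IsReducedWordOf u w ×
                                                   LusztigDatum μ (u ++ v) n × VanishAfter u n)

  EveryAdaptedDatumVanishes : Set
  EveryAdaptedDatumVanishes = ∀ u v n → IsLongestWord (u ++ v) → IsReducedWordOf u w → LusztigDatum μ (u ++ v) n → VanishAfter u n

  InP⇒every : InP μ w → EveryAdaptedDatumVanishes
  InP⇒every w-top u v n uv-longest@(uv-red , _) (_ , u≈w) datum =
    LusztigAlong-vanishes u v (drop (length u) n) (LusztigAlong-drop [] u v n datum) uv-red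
      (≐-trans (≐-sym (w-top (u ++ v) uv-longest)) (≐-sym (wellDefined u w u≈w)))

  some⇒InP : SomeAdaptedDatumVanishes → InP μ w
  some⇒InP (u , v , n , uv-longest , (_ , u≈w) , datum , zeros) u₀ u₀-longest =
    ≐-trans (≐-sym (wellDefined u w u≈w))
      (≐-trans (≐-sym (LusztigAlong-zeros u v (drop (length u) n) (LusztigAlong-drop [] u v n datum) zeros))
               (wellDefined (u ++ v) u₀ (longest-unique (u ++ v) u₀ uv-longest u₀-longest)))

  every⇒some : EveryAdaptedDatumVanishes → SomeAdaptedDatumVanishes
  every⇒some every with adaptedDatum
  ... | u , v , n , uv-longest , u-word , datum = u , v , n , uv-longest , u-word , datum , every u v n uv-longest u-word datum

mainTheorem9 : ∀ {r : ℕ} (C : CartanMatrix r) (μ : Word r → Coroot r) →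
    MV.IsMVPolytope C μ → (w : Word r) →
    let open MV C
        I   = InP μ w
        II  = ∃[ u ] ∃[ v ] ∃[ n ] (IsLongestWord (u ++ v) × IsReducedWordOf u w ×
                LusztigDatum μ (u ++ v) n × VanishAfter u n)
        III = ∀ u v n → IsLongestWord (u ++ v) → IsReducedWordOf u w →
                LusztigDatum μ (u ++ v) n → VanishAfter u n
    in (I → II) × (II → I) × (I → III) × (III → I)
mainTheorem9 C μ P w = every⇒some ∘ InP⇒every , some⇒InP , InP⇒every , some⇒InP ∘ every⇒some
  where open Criterion C μ P w
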